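{- For every positive integer $n$, the set of sizes of the orbits of the action of ${\rm Aut}(\Lambda_n)$ on $V(\Lambda_n)$ is \[ \{|X|;\ X \text{ a vertex orbit of } \Lambda_n\}\ =\ \{k \ge 1;\ k \mid n\} \cup \{k \ge 18;\ k \mid 2n\}. \]
   Context: A Lucas string of length $n$ is a binary string $u_1u_2\cdots u_n\in\{0,1\}^n$ with no two consecutive 1s and such that not both $u_1=1$ and $u_n=1$. The Lucas cube $\Lambda_n$ is the subgraph of the $n$-cube $Q_n$ (vertices: binary strings of length $n$, adjacent iff they differ in exactly one position) induced by the Lucas strings of length $n$. ${\rm Aut}(\Lambda_n)$ is its automorphism group, acting naturally on the vertex set $V(\Lambda_n)$; the vertex orbits are the orbits of this action. -}

module Defs where

open import Data.Bool using (Bool; true; false; _∧_; not; T)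
open import Data.Nat using (ℕ; zero; suc)
open import Data.List using (List; []; _∷_; length)
open import Data.Vec using (Vec; []; _∷_; toList)
open import Data.Product using (Σ; ∃; _×_; proj₁)
open import Function.Bundles using (_↔_; _⇔_; Inverse)
open import Relation.Binary.PropositionalEquality using (_≡_)
open import Data.List.Membership.Propositional using (_∈_)
open import Data.List.Relation.Unary.Unique.Propositional using (Unique)

-- no two consecutive 1s (true = 1)
noConsec : List Bool → Bool
noConsec []                    = true
noConsec (true ∷ true ∷ _)     = false
noConsec (_ ∷ xs)              = noConsec xs

lastOr : Bool → List Bool → Bool
lastOr x []       = x
lastOr _ (y ∷ ys) = lastOr y ys

firstAndLast : List Bool → Bool
firstAndLast []       = false
firstAndLast (x ∷ xs) = x ∧ lastOr x xs

isLucas : ∀ {n} → Vec Bool n → Bool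
isLucas u = noConsec (toList u) ∧ not (firstAndLast (toList u))

Vertex : ℕ → Set
Vertex n = Σ (Vec Bool n) (λ u → T (isLucas u))

hamming : ∀ {n} → Vec Bool n → Vec Bool n → ℕ
hamming [] [] = zero
hamming (true ∷ u) (true ∷ v) = hamming u v
hamming (false ∷ u) (false ∷ v) = hamming u v
hamming (_ ∷ u) (_ ∷ v) = suc (hamming u v)

Adj : ∀ {n} → Vertex n → Vertex n → Set
Adj x y = hamming (proj₁ x) (proj₁ y) ≡ 1

record Aut (n : ℕ) : Set where
  field
    perm     : Vertex n ↔ Vertex n
    preserve : ∀ x y → Adj x y ⇔ Adj (Inverse.to perm x) (Inverse.to perm y)

InOrbit : ∀ {n} → Vertex n → Vertex n → Set
InOrbit {n} v w = ∃ λ (σ : Aut n) → Inverse.to (Aut.perm σ) v ≡ w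

IsOrbitSize : ℕ → ℕ → Set
IsOrbitSize n k =
  ∃ λ (v : Vertex n) → ∃ λ (xs : List (Vertex n)) →
    Unique xs × length xs ≡ k × (∀ w → (w ∈ xs) ⇔ InOrbit v w)

module Submission where

-- A Lucas string of length n is read cyclically: it is a cyclic word with no
-- two adjacent 1s, and adjacency in Λₙ is flipping a single bit.  The proof:
--  1. Rotations and the reflection of positions are automorphisms (Dihedral).
--  2. Conversely every automorphism is dihedral (n ≥ 2): it fixes 0, the unique
--     vertex of degree n (ZeroIsFixed); it permutes the units eᵢ, and eᵢ, eⱼ
--     have a nonzero common neighbour iff i, j are distinct and not cyclically
--     adjacent (CommonNeighbours); so after composing with a dihedral symmetry
--     it fixes every eᵢ (Rigidity), hence every vertex (Reconstruction).
--  3. A dihedral orbit has p elements if the string has rotation period p and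
--     is achiral, and 2p if it is chiral (Periods, OrbitCounting); p divides n.
--  4. Strings of period p ≤ 8 are achiral, by a finite check (ShortPeriods),
--     while explicit strings realise every allowed size (Witnesses).

open import Defs
open import Data.Bool using (Bool; true; false; _∧_; _∨_; not; T; _xor_)
open import Data.Bool.Properties
  using (T?; T-irrelevant; T-≡; T-∧; T-∨; T-not-≡; not-¬; ∧-zeroʳ; xor-comm; xor-same; xor-identityʳ)
  renaming (_≟_ to _≟ᴮ_)
open import Data.Nat
open import Data.Nat.Properties
open import Data.Nat.DivMod
open import Data.Nat.Divisibility
  using (_∣_; ∣n⇒∣m*n; *-monoʳ-∣; *-cancelˡ-∣; ∣⇒≤; 0∣⇒≡0; m%n≡0⇒n∣m; n∣m⇒m%n≡0)
open import Data.Nat.Coprimality using (Coprime; coprime-divisor)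
open import Data.Nat.Tactic.RingSolver using (solve-∀)
open import Data.Fin as Fin using (Fin; toℕ; fromℕ<; punchOut)
import Data.Fin.Properties as Finₚ
open import Data.Vec using (Vec; []; _∷_; lookup; tabulate; toList)
open import Data.Vec.Properties using (lookup∘tabulate; tabulate∘lookup; tabulate-cong; ≡-dec)
open import Data.List as List using (List; []; _∷_; length; _++_)
open import Data.List.Properties using (length-tabulate; length-++)
open import Data.List.Membership.Propositional using (_∈_)
open import Data.List.Membership.Propositional.Properties
  using (∈-tabulate⁺; ∈-tabulate⁻; ∈-++⁺ˡ; ∈-++⁺ʳ; ∈-++⁻)
open import Data.List.Membership.Propositional.Properties.WithK using (unique∧set⇒bag)
open import Data.List.Relation.Unary.Unique.Propositional using (Unique)
open import Data.List.Relation.Unary.Unique.Propositional.Properties using (tabulate⁺; ++⁺)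
open import Data.List.Relation.Binary.BagAndSetEquality using (∼bag⇒↭)
open import Data.List.Relation.Binary.Permutation.Propositional.Properties using (↭-length)
open import Data.Product using (∃; _×_; _,_; proj₁; proj₂)
open import Data.Sum using (_⊎_; inj₁; inj₂)
open import Data.Empty using (⊥; ⊥-elim)
open import Data.Unit using (tt)
open import Function.Base using (case_of_)
open import Function.Bundles using (_⇔_; Inverse; Equivalence; mk↔ₛ′; mk⇔)
open import Relation.Binary.PropositionalEquality
open import Relation.Nullary using (¬_; Dec; yes; no)

module Modular where

  -- Congruence modulo the positive modulus 1+d.  Indices of Lucas strings of
  -- length 1+d are read cyclically, so all index arithmetic happens here.
  record ModEq (d a b : ℕ) : Set where
    constructor modEq
    field residues : a % suc d ≡ b % suc d
  open ModEq public

  module _ {d : ℕ} where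
    private
      N = suc d

    ≡ₘ-refl : ∀ {a} → ModEq d a a
    ≡ₘ-refl = modEq refl

    ≡ₘ-sym : ∀ {a b} → ModEq d a b → ModEq d b a
    ≡ₘ-sym (modEq e) = modEq (sym e)

    ≡ₘ-trans : ∀ {a b c} → ModEq d a b → ModEq d b c → ModEq d a c
    ≡ₘ-trans (modEq e) (modEq f) = modEq (trans e f)

    ≡ₘ-reflexive : ∀ {a b} → a ≡ b → ModEq d a b
    ≡ₘ-reflexive refl = ≡ₘ-refl

    ≡ₘ-+ : ∀ {a b c e} → ModEq d a b → ModEq d c e → ModEq d (a + c) (b + e)
    ≡ₘ-+ {a} {b} {c} {e} (modEq p) (modEq q) = modEq (begin
      (a + c) % N              ≡⟨ %-distribˡ-+ a c N ⟩
      (a % N + c % N) % N      ≡⟨ cong₂ (λ x y → (x + y) % N) p q ⟩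
      (b % N + e % N) % N      ≡⟨ %-distribˡ-+ b e N ⟨
      (b + e) % N              ∎)
      where open ≡-Reasoning

    ≡ₘ-* : ∀ {a b c e} → ModEq d a b → ModEq d c e → ModEq d (a * c) (b * e)
    ≡ₘ-* {a} {b} {c} {e} (modEq p) (modEq q) = modEq (begin
      (a * c) % N              ≡⟨ %-distribˡ-* a c N ⟩
      (a % N * (c % N)) % N    ≡⟨ cong₂ (λ x y → (x * y) % N) p q ⟩
      (b % N * (e % N)) % N    ≡⟨ %-distribˡ-* b e N ⟨
      (b * e) % N              ∎)
      where open ≡-Reasoning

    ≡ₘ-+multiple : ∀ a k → ModEq d (a + k * N) a
    ≡ₘ-+multiple a k = modEq ([m+kn]%n≡m%n a k N)

    ≡ₘ-multiple : ∀ k → ModEq d (k * N) 0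
    ≡ₘ-multiple k = ≡ₘ-+multiple 0 k

    ≡ₘ-modulus : ModEq d N 0
    ≡ₘ-modulus = ≡ₘ-trans (≡ₘ-reflexive (sym (*-identityˡ N))) (≡ₘ-multiple 1)

    ≡ₘ-% : ∀ a → ModEq d (a % N) a
    ≡ₘ-% a = modEq (m%n%n≡m%n a N)

    ≡ₘ⇒≡ : ∀ {a b} → a < N → b < N → ModEq d a b → a ≡ b
    ≡ₘ⇒≡ {a} {b} a<N b<N (modEq e) =
      trans (sym (m<n⇒m%n≡m a<N)) (trans e (m<n⇒m%n≡m b<N))

    -- addition is cancellative: add d·c, i.e. the inverse of c modulo N
    ≡ₘ-cancelʳ : ∀ {a b c} → ModEq d (a + c) (b + c) → ModEq d a b
    ≡ₘ-cancelʳ {a} {b} {c} e =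
      ≡ₘ-trans (≡ₘ-sym (≡ₘ-+multiple a c))
        (≡ₘ-trans (≡ₘ-reflexive (regroup d c a))
          (≡ₘ-trans (≡ₘ-+ e (≡ₘ-refl {d * c}))
            (≡ₘ-trans (≡ₘ-reflexive (sym (regroup d c b))) (≡ₘ-+multiple b c))))
      where
      regroup : ∀ d c x → x + c * suc d ≡ x + c + d * c
      regroup = solve-∀

    -- d ≡ -1, hence multiplication by d is an involution
    d*d*x≡ₘx : ∀ x → ModEq d (d * (d * x)) x
    d*d*x≡ₘx x = ≡ₘ-cancelʳ {c = d * x}
      (≡ₘ-trans (≡ₘ-reflexive (lhs d x)) (≡ₘ-trans (≡ₘ-multiple (d * x))
        (≡ₘ-trans (≡ₘ-sym (≡ₘ-multiple x)) (≡ₘ-reflexive (rhs d x)))))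
      where
      lhs : ∀ d x → d * (d * x) + d * x ≡ (d * x) * suc d
      lhs = solve-∀
      rhs : ∀ d x → x * suc d ≡ x + d * x
      rhs = solve-∀

    c+d*c≡ₘ0 : ∀ c → ModEq d (c + d * c) 0
    c+d*c≡ₘ0 c =
      ≡ₘ-trans (≡ₘ-reflexive (trans (cong (c +_) (*-comm d c)) (sym (*-suc c d)))) (≡ₘ-multiple c)

    _≡ₘ?_ : ∀ a b → Dec (ModEq d a b)
    a ≡ₘ? b with a % N ≟ b % N
    ... | yes e = yes (modEq e)
    ... | no ne = no (λ e → ne (residues e))

    δ : ℕ → ℕ → Bool
    δ j k = (j % N) ≡ᵇ (k % N)

    δ⇒≡ₘ : ∀ {j k} → T (δ j k) → ModEq d j k
    δ⇒≡ₘ {j} {k} t = modEq (≡ᵇ⇒≡ (j % N) (k % N) t)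

    ≡ₘ⇒δ : ∀ {j k} → ModEq d j k → δ j k ≡ true
    ≡ₘ⇒δ {j} {k} (modEq e) = Equivalence.to T-≡ (≡⇒≡ᵇ (j % N) (k % N) e)

    ≢ₘ⇒δ : ∀ {j k} → ¬ ModEq d j k → δ j k ≡ false
    ≢ₘ⇒δ {j} {k} ne with δ j k in eq
    ... | false = refl
    ... | true = ⊥-elim (ne (δ⇒≡ₘ (Equivalence.from T-≡ eq)))

    δ-refl : ∀ j → δ j j ≡ true
    δ-refl j = ≡ₘ⇒δ (≡ₘ-refl {j})

    δ-resp : ∀ {a b a' b'} → (ModEq d a b → ModEq d a' b') → (ModEq d a' b' → ModEq d a b) → δ a b ≡ δ a' b'
    δ-resp {a} {b} {a'} {b'} f g with a ≡ₘ? b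
    ... | yes e = trans (≡ₘ⇒δ e) (sym (≡ₘ⇒δ (f e)))
    ... | no ne = trans (≢ₘ⇒δ ne) (sym (≢ₘ⇒δ (λ e → ne (g e))))

    δ-respˡ : ∀ {j j' k} → ModEq d j j' → δ j k ≡ δ j' k
    δ-respˡ {k = k} (modEq e) = cong (_≡ᵇ (k % N)) e

    δ-respʳ : ∀ {j k k'} → ModEq d k k' → δ j k ≡ δ j k'
    δ-respʳ {j} (modEq e) = cong ((j % N) ≡ᵇ_) e

module CyclicStrings where
  open Modular

  ix : ∀ {d} → Vec Bool (suc d) → ℕ → Bool
  ix {d} v i = lookup v (i mod suc d)

  ix-≡ₘ : ∀ {d} (v : Vec Bool (suc d)) {a b} → ModEq d a b → ix v a ≡ ix v b
  ix-≡ₘ {d} v (modEq e) = cong (lookup v) (Finₚ.toℕ-injective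
    (trans (Finₚ.toℕ-fromℕ< _) (trans e (sym (Finₚ.toℕ-fromℕ< _)))))

  ix-ext : ∀ {d} {u v : Vec Bool (suc d)} → (∀ i → ix u i ≡ ix v i) → u ≡ v
  ix-ext {d} {u} {v} h = begin
    u                            ≡⟨ tabulate∘lookup u ⟨
    tabulate (lookup u)          ≡⟨ tabulate-cong (λ j → trans (lookup-ix u j) (trans (h (toℕ j)) (sym (lookup-ix v j)))) ⟩
    tabulate (lookup v)          ≡⟨ tabulate∘lookup v ⟩
    v                            ∎
    where
    open ≡-Reasoning
    lookup-ix : ∀ (w : Vec Bool (suc d)) j → lookup w j ≡ ix w (toℕ j)
    lookup-ix w j = cong (lookup w) (sym (Finₚ.toℕ-injective
      (trans (Finₚ.toℕ-fromℕ< _) (m<n⇒m%n≡m (Finₚ.toℕ<n j)))))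

  ix-cong : ∀ {d} {u v : Vec Bool (suc d)} → u ≡ v → ∀ i → ix u i ≡ ix v i
  ix-cong refl i = refl

  tab : ∀ {d} → (ℕ → Bool) → Vec Bool (suc d)
  tab f = tabulate (λ j → f (toℕ j))

  ix-tab : ∀ {d} (f : ℕ → Bool) i → ix {d} (tab f) i ≡ f (i % suc d)
  ix-tab {d} f i = trans (lookup∘tabulate (λ j → f (toℕ j)) (i mod suc d)) (cong f (Finₚ.toℕ-fromℕ< _))

  vertex-≡ : ∀ {n} {x y : Vertex n} → proj₁ x ≡ proj₁ y → x ≡ y
  vertex-≡ {x = u , p} {y = .u , q} refl = cong (u ,_) (T-irrelevant p q)

  false≢true : false ≢ true
  false≢true ()

  at : List Bool → ℕ → Bool
  at [] _ = false
  at (x ∷ _) zero = x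
  at (_ ∷ xs) (suc j) = at xs j

  at-beyond : ∀ {k} (v : Vec Bool k) j → k ≤ j → at (toList v) j ≡ false
  at-beyond [] j _ = refl
  at-beyond (x ∷ v) (suc j) (s≤s k≤j) = at-beyond v j k≤j

  ix-at : ∀ {d} (v : Vec Bool (suc d)) i → i < suc d → ix v i ≡ at (toList v) i
  ix-at {d} v i i<N = trans (lookup-at v (i mod suc d)) (cong (at (toList v)) (trans (Finₚ.toℕ-fromℕ< _) (m<n⇒m%n≡m i<N)))
    where
    lookup-at : ∀ {k} (w : Vec Bool k) (j : Fin k) → lookup w j ≡ at (toList w) (toℕ j)
    lookup-at (x ∷ w) Fin.zero = refl
    lookup-at (x ∷ w) (Fin.suc j) = lookup-at w j

  at-ext : ∀ {k} (u v : Vec Bool k) → (∀ j → at (toList u) j ≡ at (toList v) j) → u ≡ v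
  at-ext [] [] h = refl
  at-ext (x ∷ u) (y ∷ v) h = cong₂ _∷_ (h zero) (at-ext u v (λ j → h (suc j)))

  noConsec-sound : ∀ xs → T (noConsec xs) → ∀ j → T (at xs j) → T (at xs (suc j)) → ⊥
  noConsec-sound (true ∷ true ∷ r) () zero a b
  noConsec-sound (true ∷ false ∷ r) h zero a ()
  noConsec-sound (true ∷ []) h zero a ()
  noConsec-sound (false ∷ xs) h zero () b
  noConsec-sound (false ∷ xs) h (suc j) a b = noConsec-sound xs h j a b
  noConsec-sound (true ∷ []) h (suc j) () b
  noConsec-sound (true ∷ false ∷ r) h (suc j) a b = noConsec-sound (false ∷ r) h j a b

  noConsec-complete : ∀ xs → (∀ j → T (at xs j) → T (at xs (suc j)) → ⊥) → T (noConsec xs)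
  noConsec-complete [] h = tt
  noConsec-complete (false ∷ xs) h = noConsec-complete xs (λ j → h (suc j))
  noConsec-complete (true ∷ []) h = tt
  noConsec-complete (true ∷ true ∷ r) h = ⊥-elim (h 0 tt tt)
  noConsec-complete (true ∷ false ∷ r) h = noConsec-complete (false ∷ r) (λ j → h (suc j))

  firstAndLast-at : ∀ {d} (v : Vec Bool (suc d)) → firstAndLast (toList v) ≡ at (toList v) 0 ∧ at (toList v) d
  firstAndLast-at {d} (x ∷ w) = cong (x ∧_) (trans (lastOr-at x (toList w)) (cong (at (x ∷ toList w)) (Data.Vec.Properties.length-toList w)))
    where
    lastOr-at : ∀ x xs → lastOr x xs ≡ at (x ∷ xs) (length xs)
    lastOr-at x [] = refl
    lastOr-at x (y ∷ ys) = lastOr-at y ys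

  NoAdjacentOnes : ∀ {d} → Vec Bool (suc d) → Set
  NoAdjacentOnes v = ∀ i → T (ix v i) → T (ix v (suc i)) → ⊥

  -- an adjacent pair inside the string violates noConsec; one wrapping
  -- around (positions d and 0) violates the first-and-last condition
  lucas⇒noAdjacentOnes : ∀ {d} (v : Vec Bool (suc d)) → T (isLucas v) → NoAdjacentOnes v
  lucas⇒noAdjacentOnes {d} v lucas i vi vi+1 with Equivalence.to T-∧ lucas | suc (i % suc d) <? suc d
  ... | noCons , _ | yes inside = noConsec-sound (toList v) noCons (i % suc d)
        (subst T (trans (ix-≡ₘ v (≡ₘ-sym (≡ₘ-% i))) (ix-at v _ (<-trans (n<1+n _) inside))) vi)
        (subst T (trans (ix-≡ₘ v (≡ₘ-+ (≡ₘ-refl {a = 1}) (≡ₘ-sym (≡ₘ-% i)))) (ix-at v _ inside)) vi+1)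
  ... | _ , notFirstAndLast | no wraps =
        false≢true (trans (sym (Equivalence.to T-not-≡ notFirstAndLast)) (trans (firstAndLast-at v)
          (cong₂ _∧_ (Equivalence.to T-≡ first) (Equivalence.to T-≡ last))))
    where
    i≡d : i % suc d ≡ d
    i≡d = ≤-antisym (s≤s⁻¹ (m%n<n i (suc d))) (s≤s⁻¹ (s≤s⁻¹ (≰⇒> wraps)))
    last : T (at (toList v) d)
    last = subst T (trans (ix-≡ₘ v (≡ₘ-trans (≡ₘ-sym (≡ₘ-% i)) (≡ₘ-reflexive i≡d))) (ix-at v d ≤-refl)) vi
    first : T (at (toList v) 0)
    first = subst T (trans (ix-≡ₘ v (≡ₘ-trans (≡ₘ-+ (≡ₘ-refl {a = 1}) (≡ₘ-sym (≡ₘ-% i)))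
              (≡ₘ-trans (≡ₘ-reflexive (cong suc i≡d)) ≡ₘ-modulus))) (ix-at v 0 z<s)) vi+1

  noAdjacentOnes⇒lucas : ∀ {d} (v : Vec Bool (suc d)) → NoAdjacentOnes v → T (isLucas v)
  noAdjacentOnes⇒lucas {d} v free =
    Equivalence.from T-∧ (noConsec-complete (toList v) linear , Equivalence.from T-not-≡ notFirstAndLast)
    where
    linear : ∀ j → T (at (toList v) j) → T (at (toList v) (suc j)) → ⊥
    linear j a b with suc j <? suc d
    ... | yes inside = free j (subst T (sym (ix-at v j (<-trans (n<1+n _) inside))) a) (subst T (sym (ix-at v (suc j) inside)) b)
    ... | no outside = subst T (at-beyond v (suc j) (s≤s⁻¹ (≰⇒> outside))) b
    notFirstAndLast : firstAndLast (toList v) ≡ false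
    notFirstAndLast with at (toList v) 0 in first | at (toList v) d in last
    ... | false | _ = trans (firstAndLast-at v) (cong (_∧ at (toList v) d) first)
    ... | true | false = trans (firstAndLast-at v) (cong₂ _∧_ first last)
    ... | true | true = ⊥-elim (free d (subst T (sym (trans (ix-at v d ≤-refl) last)) tt)
                                      (subst T (sym (trans (ix-≡ₘ v ≡ₘ-modulus) (trans (ix-at v 0 z<s) first))) tt))

  noAdjacentOnes : ∀ {d} (x : Vertex (suc d)) → NoAdjacentOnes (proj₁ x)
  noAdjacentOnes (v , lucas) = lucas⇒noAdjacentOnes v lucas

module Automorphisms where

  module _ {n : ℕ} where

    mkAut : (f g : Vertex n → Vertex n) → (∀ x → f (g x) ≡ x) → (∀ x → g (f x) ≡ x) →
            (∀ x y → Adj x y → Adj (f x) (f y)) → (∀ x y → Adj x y → Adj (g x) (g y)) → Aut n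
    mkAut f g fg gf f-adj g-adj = record
      { perm = mk↔ₛ′ f g fg gf
      ; preserve = λ x y → mk⇔ (f-adj x y) (λ a → subst₂ Adj (gf x) (gf y) (g-adj _ _ a)) }

    apply : Aut n → Vertex n → Vertex n
    apply σ = Inverse.to (Aut.perm σ)

    unapply : Aut n → Vertex n → Vertex n
    unapply σ = Inverse.from (Aut.perm σ)

    apply-unapply : ∀ (σ : Aut n) x → apply σ (unapply σ x) ≡ x
    apply-unapply σ x = Inverse.inverseˡ (Aut.perm σ) refl

    unapply-apply : ∀ (σ : Aut n) x → unapply σ (apply σ x) ≡ x
    unapply-apply σ x = Inverse.inverseʳ (Aut.perm σ) refl

    apply-Adj : ∀ (σ : Aut n) x y → Adj x y → Adj (apply σ x) (apply σ y)
    apply-Adj σ x y = Equivalence.to (Aut.preserve σ x y)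

    apply-Adj⁻ : ∀ (σ : Aut n) x y → Adj (apply σ x) (apply σ y) → Adj x y
    apply-Adj⁻ σ x y = Equivalence.from (Aut.preserve σ x y)

    unapply-Adj : ∀ (σ : Aut n) x y → Adj x y → Adj (unapply σ x) (unapply σ y)
    unapply-Adj σ x y a = apply-Adj⁻ σ _ _ (subst₂ Adj (sym (apply-unapply σ x)) (sym (apply-unapply σ y)) a)

    apply-injective : ∀ (σ : Aut n) {x y} → apply σ x ≡ apply σ y → x ≡ y
    apply-injective σ {x} {y} e = trans (sym (unapply-apply σ x)) (trans (cong (unapply σ) e) (unapply-apply σ y))

    _∘ᴬ_ : Aut n → Aut n → Aut n
    σ ∘ᴬ τ = mkAut (λ x → apply σ (apply τ x)) (λ x → unapply τ (unapply σ x))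
      (λ x → trans (cong (apply σ) (apply-unapply τ _)) (apply-unapply σ x))
      (λ x → trans (cong (unapply τ) (unapply-apply σ _)) (unapply-apply τ x))
      (λ x y a → apply-Adj σ _ _ (apply-Adj τ x y a))
      (λ x y a → unapply-Adj τ _ _ (unapply-Adj σ x y a))

module Adjacency where
  open Modular
  open CyclicStrings

  hamming-self : ∀ {k} (u : Vec Bool k) → hamming u u ≡ 0
  hamming-self [] = refl
  hamming-self (true ∷ u) = hamming-self u
  hamming-self (false ∷ u) = hamming-self u

  hamming-0 : ∀ {k} (u v : Vec Bool k) → hamming u v ≡ 0 → u ≡ v
  hamming-0 [] [] _ = refl
  hamming-0 (true ∷ u) (true ∷ v) h = cong (true ∷_) (hamming-0 u v h)
  hamming-0 (false ∷ u) (false ∷ v) h = cong (false ∷_) (hamming-0 u v h)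

  LinearFlip : ℕ → List Bool → List Bool → Set
  LinearFlip k l l' = ∀ j → at l' j ≡ (j ≡ᵇ k) xor at l j

  hamming-1⇒flip : ∀ {k} (u v : Vec Bool k) → hamming u v ≡ 1 → ∃ λ t → t < k × LinearFlip t (toList u) (toList v)
  hamming-1⇒flip [] [] ()
  hamming-1⇒flip (true ∷ u) (false ∷ v) h rewrite hamming-0 u v (suc-injective h) = 0 , z<s , λ { zero → refl ; (suc j) → refl }
  hamming-1⇒flip (false ∷ u) (true ∷ v) h rewrite hamming-0 u v (suc-injective h) = 0 , z<s , λ { zero → refl ; (suc j) → refl }
  hamming-1⇒flip (true ∷ u) (true ∷ v) h with hamming-1⇒flip u v h
  ... | t , t<k , f = suc t , s≤s t<k , λ { zero → refl ; (suc j) → f j }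
  hamming-1⇒flip (false ∷ u) (false ∷ v) h with hamming-1⇒flip u v h
  ... | t , t<k , f = suc t , s≤s t<k , λ { zero → refl ; (suc j) → f j }

  flip⇒hamming-1 : ∀ {k} (u v : Vec Bool k) t → LinearFlip t (toList u) (toList v) → hamming u v ≡ 1
  flip⇒hamming-1 [] [] t f = ⊥-elim (false≢true (trans (f t) (cong (_xor false) (Equivalence.to T-≡ (≡⇒≡ᵇ t t refl)))))
  flip⇒hamming-1 (a ∷ u) (b ∷ v) zero f with at-ext u v (λ j → sym (f (suc j))) | f zero
  flip⇒hamming-1 (true ∷ u) (false ∷ .u) zero f | refl | _ = cong suc (hamming-self u)
  flip⇒hamming-1 (false ∷ u) (true ∷ .u) zero f | refl | _ = cong suc (hamming-self u)
  flip⇒hamming-1 (true ∷ u) (true ∷ .u) zero f | refl | ()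
  flip⇒hamming-1 (false ∷ u) (false ∷ .u) zero f | refl | ()
  flip⇒hamming-1 (a ∷ u) (b ∷ v) (suc t) f with f zero
  flip⇒hamming-1 (true ∷ u) (true ∷ v) (suc t) f | _ = flip⇒hamming-1 u v t (λ j → f (suc j))
  flip⇒hamming-1 (false ∷ u) (false ∷ v) (suc t) f | _ = flip⇒hamming-1 u v t (λ j → f (suc j))
  flip⇒hamming-1 (true ∷ u) (false ∷ v) (suc t) f | ()
  flip⇒hamming-1 (false ∷ u) (true ∷ v) (suc t) f | ()

  xor-cancelˡ : ∀ x y → x xor (x xor y) ≡ y
  xor-cancelˡ true true = refl
  xor-cancelˡ true false = refl
  xor-cancelˡ false y = refl

  xor-cancelʳ : ∀ x y → x xor (y xor x) ≡ y
  xor-cancelʳ x y = trans (cong (x xor_) (xor-comm y x)) (xor-cancelˡ x y)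

  xor-swap : ∀ x y z → x xor (y xor z) ≡ y xor (x xor z)
  xor-swap true true z = refl
  xor-swap true false z = refl
  xor-swap false y z = refl

  Flip : ∀ {d} → ℕ → Vec Bool (suc d) → Vec Bool (suc d) → Set
  Flip {d} k u v = ∀ j → ix v j ≡ δ {d} j k xor ix u j

  Flip-≡ₘ : ∀ {d} {k k'} {u v : Vec Bool (suc d)} → ModEq d k k' → Flip k u v → Flip k' u v
  Flip-≡ₘ {d} {k} {k'} {u} e f j = trans (f j) (cong (_xor ix u j) (δ-respʳ {d} {j} e))

  module _ {d : ℕ} where
    private
      N = suc d

    Flip-sym : ∀ {k} {u v : Vec Bool N} → Flip k u v → Flip k v u
    Flip-sym {k} {u} {v} f j = trans (sym (xor-cancelˡ (δ j k) (ix u j))) (cong (δ j k xor_) (sym (f j)))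

    Flip-functional : ∀ {k} {u v w : Vec Bool N} → Flip k u v → Flip k u w → v ≡ w
    Flip-functional f g = ix-ext λ j → trans (f j) (sym (g j))


    Adj⇒Flip : ∀ (x y : Vertex N) → Adj x y → ∃ λ k → k < N × Flip k (proj₁ x) (proj₁ y)
    Adj⇒Flip (u , _) (v , _) adj with hamming-1⇒flip u v adj
    ... | t , t<N , f = t , t<N , λ j → begin
      ix v j                                    ≡⟨ ix-≡ₘ v (≡ₘ-sym (≡ₘ-% j)) ⟩
      ix v (j % N)                              ≡⟨ ix-at v _ (m%n<n j N) ⟩
      at (toList v) (j % N)                     ≡⟨ f (j % N) ⟩
      (j % N ≡ᵇ t) xor at (toList u) (j % N)    ≡⟨ cong₂ (λ a b → (j % N ≡ᵇ a) xor b) (sym (m<n⇒m%n≡m t<N))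
                                                     (trans (sym (ix-at u _ (m%n<n j N))) (ix-≡ₘ u (≡ₘ-% j))) ⟩
      δ j t xor ix u j                          ∎
      where open ≡-Reasoning

    Flip⇒Adj : ∀ (x y : Vertex N) k → Flip k (proj₁ x) (proj₁ y) → Adj x y
    Flip⇒Adj (u , _) (v , _) k f = flip⇒hamming-1 u v (k % N) linear
      where
      linear : LinearFlip (k % N) (toList u) (toList v)
      linear j with j <? N
      ... | yes j<N = trans (sym (ix-at v j j<N)) (trans (f j)
                        (cong₂ (λ a b → (a ≡ᵇ k % N) xor b) (m<n⇒m%n≡m j<N) (ix-at u j j<N)))
      ... | no j≮N = trans (at-beyond v j N≤j) (sym (cong₂ _xor_ j≢k (at-beyond u j N≤j)))
        where
        N≤j : N ≤ j
        N≤j = ≮⇒≥ j≮N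
        j≢k : (j ≡ᵇ k % N) ≡ false
        j≢k with j ≡ᵇ k % N in eq
        ... | false = refl
        ... | true = ⊥-elim (<⇒≱ (subst (_< N) (sym (≡ᵇ⇒≡ j (k % N) (Equivalence.from T-≡ eq))) (m%n<n k N)) N≤j)

    Adj-sym : ∀ (x y : Vertex N) → Adj x y → Adj y x
    Adj-sym x y a with Adj⇒Flip x y a
    ... | k , _ , f = Flip⇒Adj y x k (Flip-sym {k} {proj₁ x} {proj₁ y} f)

module Dihedral where
  open Modular
  open CyclicStrings
  open Automorphisms
  open Adjacency

  -- The dihedral group acts on cyclic strings by rotations i ↦ c + i and the
  -- reflection i ↦ -i (written d·i, as d ≡ -1); both preserve the Lucas
  -- condition and bit flips, so they are automorphisms of the Lucas cube.
  module _ {d : ℕ} where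
    private
      N = suc d
      V = Vec Bool N

    -- c + j ≡ k  iff  j ≡ k - c, i.e. k + d·c
    shift-≡ₘ⇒ : ∀ {c j k} → ModEq d (c + j) k → ModEq d j (k + d * c)
    shift-≡ₘ⇒ {c} {j} {k} e =
      ≡ₘ-trans (≡ₘ-sym (≡ₘ-trans (≡ₘ-+ (≡ₘ-refl {a = j}) (c+d*c≡ₘ0 c)) (≡ₘ-reflexive (+-identityʳ j))))
        (≡ₘ-trans (≡ₘ-reflexive (regroup j c (d * c))) (≡ₘ-+ e (≡ₘ-refl {a = d * c})))
      where
      regroup : ∀ j c x → j + (c + x) ≡ c + j + x
      regroup = solve-∀

    shift-≡ₘ⇐ : ∀ {c j k} → ModEq d j (k + d * c) → ModEq d (c + j) k
    shift-≡ₘ⇐ {c} {j} {k} e =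
      ≡ₘ-trans (≡ₘ-+ (≡ₘ-refl {a = c}) e)
        (≡ₘ-trans (≡ₘ-reflexive (regroup c k (d * c)))
          (≡ₘ-trans (≡ₘ-+ (≡ₘ-refl {a = k}) (c+d*c≡ₘ0 c)) (≡ₘ-reflexive (+-identityʳ k))))
      where
      regroup : ∀ c k x → c + (k + x) ≡ k + (c + x)
      regroup = solve-∀

    negate-≡ₘ : ∀ {j k} → ModEq d (d * j) k → ModEq d j (d * k)
    negate-≡ₘ {j} e = ≡ₘ-trans (≡ₘ-sym (d*d*x≡ₘx j)) (≡ₘ-* (≡ₘ-refl {a = d}) e)

    d*c+c≡ₘ0 : ∀ c → ModEq d (d * c + c) 0
    d*c+c≡ₘ0 c = ≡ₘ-trans (≡ₘ-reflexive (+-comm (d * c) c)) (c+d*c≡ₘ0 c)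

    rot : ℕ → V → V
    rot c v = tab (λ j → ix v (c + j))

    ref : V → V
    ref v = tab (λ j → ix v (d * j))

    ix-rot : ∀ c v i → ix (rot c v) i ≡ ix v (c + i)
    ix-rot c v i = trans (ix-tab {d} (λ j → ix v (c + j)) i) (ix-≡ₘ v (≡ₘ-+ (≡ₘ-refl {a = c}) (≡ₘ-% i)))

    ix-ref : ∀ v i → ix (ref v) i ≡ ix v (d * i)
    ix-ref v i = trans (ix-tab {d} (λ j → ix v (d * j)) i) (ix-≡ₘ v (≡ₘ-* (≡ₘ-refl {a = d}) (≡ₘ-% i)))

    rot-rot : ∀ a b v → rot a (rot b v) ≡ rot (b + a) v
    rot-rot a b v = ix-ext λ i → trans (ix-rot a (rot b v) i)
      (trans (ix-rot b v (a + i)) (trans (cong (ix v) (sym (+-assoc b a i))) (sym (ix-rot (b + a) v i))))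

    rot-≡ₘ : ∀ {a b} v → ModEq d a b → rot a v ≡ rot b v
    rot-≡ₘ {a} {b} v e = ix-ext λ i →
      trans (ix-rot a v i) (trans (ix-≡ₘ v (≡ₘ-+ e (≡ₘ-refl {a = i}))) (sym (ix-rot b v i)))

    rot-0 : ∀ v → rot 0 v ≡ v
    rot-0 v = ix-ext λ i → ix-rot 0 v i

    rot-≡ₘ0 : ∀ {a} v → ModEq d a 0 → rot a v ≡ v
    rot-≡ₘ0 v e = trans (rot-≡ₘ v e) (rot-0 v)

    rot-inverseˡ : ∀ c v → rot (d * c) (rot c v) ≡ v
    rot-inverseˡ c v = trans (rot-rot (d * c) c v) (rot-≡ₘ0 v (c+d*c≡ₘ0 c))

    rot-inverseʳ : ∀ c v → rot c (rot (d * c) v) ≡ v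
    rot-inverseʳ c v = trans (rot-rot c (d * c) v) (rot-≡ₘ0 v (d*c+c≡ₘ0 c))

    ref-ref : ∀ v → ref (ref v) ≡ v
    ref-ref v = ix-ext λ i → trans (ix-ref (ref v) i) (trans (ix-ref v (d * i)) (ix-≡ₘ v (d*d*x≡ₘx i)))

    rot-ref : ∀ c v → rot c (ref v) ≡ ref (rot (d * c) v)
    rot-ref c v = ix-ext λ i → begin
      ix (rot c (ref v)) i         ≡⟨ ix-rot c (ref v) i ⟩
      ix (ref v) (c + i)           ≡⟨ ix-ref v (c + i) ⟩
      ix v (d * (c + i))           ≡⟨ cong (ix v) (*-distribˡ-+ d c i) ⟩
      ix v (d * c + d * i)         ≡⟨ ix-rot (d * c) v (d * i) ⟨
      ix (rot (d * c) v) (d * i)   ≡⟨ ix-ref (rot (d * c) v) i ⟨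
      ix (ref (rot (d * c) v)) i   ∎
      where open ≡-Reasoning

    rot-injective : ∀ c {u v} → rot c u ≡ rot c v → u ≡ v
    rot-injective c {u} {v} e = trans (sym (rot-inverseˡ c u)) (trans (cong (rot (d * c)) e) (rot-inverseˡ c v))

    ref-injective : ∀ {u v} → ref u ≡ ref v → u ≡ v
    ref-injective {u} {v} e = trans (sym (ref-ref u)) (trans (cong ref e) (ref-ref v))

    noAdjacentOnes-rot : ∀ c v → NoAdjacentOnes v → NoAdjacentOnes (rot c v)
    noAdjacentOnes-rot c v free i a b =
      free (c + i) (subst T (ix-rot c v i) a) (subst T (trans (ix-rot c v (suc i)) (cong (ix v) (+-suc c i))) b)

    -- positions i, i+1 of ref v are positions -i-1, -i of v
    noAdjacentOnes-ref : ∀ v → NoAdjacentOnes v → NoAdjacentOnes (ref v)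
    noAdjacentOnes-ref v free i a b = free (d * suc i) (subst T (ix-ref v (suc i)) b)
      (subst T (trans (ix-ref v i) (ix-≡ₘ v (≡ₘ-sym (≡ₘ-trans (≡ₘ-reflexive (regroup d i)) (≡ₘ-+multiple (d * i) 1))))) a)
      where
      regroup : ∀ d i → suc (d * suc i) ≡ d * i + 1 * suc d
      regroup = solve-∀

    Flip-rot : ∀ c k {u v} → Flip k u v → Flip (k + d * c) (rot c u) (rot c v)
    Flip-rot c k {u} {v} f j = trans (ix-rot c v j) (trans (f (c + j))
      (cong₂ _xor_ (δ-resp (shift-≡ₘ⇒ {c} {j} {k}) (shift-≡ₘ⇐ {c} {j} {k})) (sym (ix-rot c u j))))

    Flip-ref : ∀ k {u v} → Flip k u v → Flip (d * k) (ref u) (ref v)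
    Flip-ref k {u} {v} f j = trans (ix-ref v j) (trans (f (d * j))
      (cong₂ _xor_ (δ-resp (negate-≡ₘ {j} {k}) (λ e → ≡ₘ-trans (≡ₘ-* (≡ₘ-refl {a = d}) e) (d*d*x≡ₘx k))) (sym (ix-ref u j))))

    rotV : ℕ → Vertex N → Vertex N
    rotV c x = rot c (proj₁ x) , noAdjacentOnes⇒lucas (rot c (proj₁ x)) (noAdjacentOnes-rot c (proj₁ x) (noAdjacentOnes x))

    refV : Vertex N → Vertex N
    refV x = ref (proj₁ x) , noAdjacentOnes⇒lucas (ref (proj₁ x)) (noAdjacentOnes-ref (proj₁ x) (noAdjacentOnes x))

    Adj-rotV : ∀ c x y → Adj x y → Adj (rotV c x) (rotV c y)
    Adj-rotV c x y a with Adj⇒Flip x y a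
    ... | k , _ , f = Flip⇒Adj (rotV c x) (rotV c y) (k + d * c) (Flip-rot c k {proj₁ x} {proj₁ y} f)

    Adj-refV : ∀ x y → Adj x y → Adj (refV x) (refV y)
    Adj-refV x y a with Adj⇒Flip x y a
    ... | k , _ , f = Flip⇒Adj (refV x) (refV y) (d * k) (Flip-ref k {proj₁ x} {proj₁ y} f)

    rotᴬ : ℕ → Aut N
    rotᴬ c = mkAut (rotV c) (rotV (d * c))
      (λ x → vertex-≡ (rot-inverseʳ c (proj₁ x))) (λ x → vertex-≡ (rot-inverseˡ c (proj₁ x))) (Adj-rotV c) (Adj-rotV (d * c))

    refᴬ : Aut N
    refᴬ = mkAut refV refV (λ x → vertex-≡ (ref-ref (proj₁ x))) (λ x → vertex-≡ (ref-ref (proj₁ x))) Adj-refV Adj-refV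

module UnitVectors where
  open Modular
  open CyclicStrings
  open Adjacency
  open Dihedral

  module _ {d : ℕ} where
    private
      N = suc d
      V = Vec Bool N

    zeros : V
    zeros = tab (λ _ → false)

    unit : ℕ → V
    unit k = tab (λ j → j ≡ᵇ (k % N))

    ix-zeros : ∀ i → ix zeros i ≡ false
    ix-zeros i = ix-tab {d} (λ _ → false) i

    ix-unit : ∀ k i → ix (unit k) i ≡ δ i k
    ix-unit k i = ix-tab {d} (λ j → j ≡ᵇ (k % N)) i

    unit-≡ₘ : ∀ {a b} → ModEq d a b → unit a ≡ unit b
    unit-≡ₘ {a} {b} e = ix-ext λ i → trans (ix-unit a i) (trans (δ-respʳ {d} {i} e) (sym (ix-unit b i)))

    unit-injective : ∀ {a b} → unit a ≡ unit b → ModEq d a b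
    unit-injective {a} {b} e = δ⇒≡ₘ (Equivalence.from T-≡
      (trans (sym (ix-unit b a)) (trans (sym (ix-cong e a)) (trans (ix-unit a a) (δ-refl a)))))

    noAdjacentOnes-zeros : NoAdjacentOnes zeros
    noAdjacentOnes-zeros i a _ = subst T (ix-zeros i) a

    zeroV : Vertex N
    zeroV = zeros , noAdjacentOnes⇒lucas zeros noAdjacentOnes-zeros

    rot-zeros : ∀ c → rot c zeros ≡ zeros
    rot-zeros c = ix-ext λ i → trans (ix-rot c zeros i) (trans (ix-zeros (c + i)) (sym (ix-zeros i)))

    ref-zeros : ref zeros ≡ zeros
    ref-zeros = ix-ext λ i → trans (ix-ref zeros i) (trans (ix-zeros (d * i)) (sym (ix-zeros i)))

    rot-unit : ∀ c k → rot c (unit k) ≡ unit (k + d * c)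
    rot-unit c k = ix-ext λ i → trans (ix-rot c (unit k) i) (trans (ix-unit k (c + i))
      (trans (δ-resp (shift-≡ₘ⇒ {d} {c} {i} {k}) (shift-≡ₘ⇐ {d} {c} {i} {k})) (sym (ix-unit (k + d * c) i))))

    ref-unit : ∀ k → ref (unit k) ≡ unit (d * k)
    ref-unit k = ix-ext λ i → trans (ix-ref (unit k) i) (trans (ix-unit k (d * i))
      (trans (δ-resp (negate-≡ₘ {d} {i} {k}) (λ e → ≡ₘ-trans (≡ₘ-* (≡ₘ-refl {a = d}) e) (d*d*x≡ₘx k)))
        (sym (ix-unit (d * k) i))))

    Flip-zeros-unit : ∀ k → Flip k zeros (unit k)
    Flip-zeros-unit k j = trans (ix-unit k j) (trans (sym (xor-identityʳ _)) (cong (δ j k xor_) (sym (ix-zeros j))))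

    common-neighbour-flip : ∀ {k₁ k₂ a b} {p q c : V} → ¬ ModEq d a b → Flip k₁ p c → Flip k₂ q c →
         (∀ j → ix q j ≡ δ j a xor (δ j b xor ix p j)) → ModEq d k₁ a ⊎ ModEq d k₁ b
    common-neighbour-flip {k₁} {k₂} {a} {b} {p} {q} {c} a≢b f₁ f₂ q-def with k₁ ≡ₘ? a | k₁ ≡ₘ? b
    ... | yes e | _ = inj₁ e
    ... | no _ | yes e = inj₂ e
    ... | no k₁≢a | no k₁≢b = ⊥-elim (a≢b (≡ₘ-trans (k₂-at a k₁≢a a-flip) (≡ₘ-sym (k₂-at b k₁≢b b-flip))))
      where
      -- at a position flipped in q but not by k₁, the flip k₂ must hit it
      k₂-at : ∀ x → ¬ ModEq d k₁ x → δ {d} x k₁ xor ix p x ≡ δ {d} x k₂ xor (true xor ix p x) → ModEq d x k₂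
      k₂-at x ne eq with x ≡ₘ? k₂
      ... | yes e = e
      ... | no x≢k₂ = ⊥-elim (not-¬ refl (begin
        ix p x                          ≡⟨ cong (_xor ix p x) (≢ₘ⇒δ {d} {x} {k₁} (λ e → ne (≡ₘ-sym e))) ⟨
        δ x k₁ xor ix p x               ≡⟨ eq ⟩
        δ x k₂ xor (true xor ix p x)    ≡⟨ cong (_xor (true xor ix p x)) (≢ₘ⇒δ x≢k₂) ⟩
        not (ix p x)                    ∎))
        where open ≡-Reasoning
      through-c : ∀ x → δ {d} x k₁ xor ix p x ≡ δ {d} x k₂ xor ix q x
      through-c x = trans (sym (f₁ x)) (f₂ x)
      a-flip : δ {d} a k₁ xor ix p a ≡ δ {d} a k₂ xor (true xor ix p a)
      a-flip = trans (through-c a) (cong (δ a k₂ xor_) (trans (q-def a)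
                 (cong₂ (λ x y → x xor (y xor ix p a)) (δ-refl a) (≢ₘ⇒δ a≢b))))
      b-flip : δ {d} b k₁ xor ix p b ≡ δ {d} b k₂ xor (true xor ix p b)
      b-flip = trans (through-c b) (cong (δ b k₂ xor_) (trans (q-def b) (trans (xor-swap (δ b a) (δ b b) (ix p b))
                 (cong₂ (λ x y → x xor (y xor ix p b)) (δ-refl b) (≢ₘ⇒δ (λ e → a≢b (≡ₘ-sym e)))))))

module ZeroIsFixed where
  open Modular
  open CyclicStrings
  open Automorphisms
  open Adjacency
  open UnitVectors

  -- For n ≥ 2 the zero vertex is the unique vertex of maximal degree n, its
  -- neighbours being the unit vertices; hence every automorphism fixes it.
  module _ {d : ℕ} (1≤d : 1 ≤ d) where
    private
      N = suc d

    i≢ₘi+1 : ∀ i → ¬ ModEq d i (suc i)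
    i≢ₘi+1 i e with ≡ₘ⇒≡ {d} z<s (s≤s 1≤d) (≡ₘ-cancelʳ {d} {0} {1} {i} e)
    ... | ()

    noAdjacentOnes-unit : ∀ k → NoAdjacentOnes (unit {d} k)
    noAdjacentOnes-unit k i a b = i≢ₘi+1 i (≡ₘ-trans (δ⇒≡ₘ {d} {i} {k} (subst T (ix-unit {d} k i) a))
                                                     (≡ₘ-sym (δ⇒≡ₘ {d} {suc i} {k} (subst T (ix-unit {d} k (suc i)) b))))

    unitV : ℕ → Vertex N
    unitV k = unit k , noAdjacentOnes⇒lucas (unit k) (noAdjacentOnes-unit k)

    Adj-zero-unit : ∀ k → Adj zeroV (unitV k)
    Adj-zero-unit k = Flip⇒Adj zeroV (unitV k) k (Flip-zeros-unit {d} k)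

    zero-neighbour : ∀ y → Adj zeroV y → ∃ λ k → k < N × y ≡ unitV k
    zero-neighbour y a with Adj⇒Flip zeroV y a
    ... | k , k<N , f = k , k<N , vertex-≡ (ix-ext λ i →
      trans (f i) (trans (cong (δ i k xor_) (ix-zeros {d} i)) (trans (xor-identityʳ _) (sym (ix-unit {d} k i)))))

    only-zeros⇒zeroV : ∀ (y : Vertex N) → (∀ t → t < N → ix (proj₁ y) t ≡ false) → y ≡ zeroV
    only-zeros⇒zeroV y h = vertex-≡ (ix-ext λ i →
      trans (ix-≡ₘ (proj₁ y) (≡ₘ-sym (≡ₘ-% i))) (trans (h _ (m%n<n i N)) (sym (ix-zeros {d} i))))

    -- A vertex with a 1 at position t has fewer than N neighbours: the flip
    -- positions of distinct neighbours are distinct and avoid t+1.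
    degree-bound : ∀ (y : Vertex N) t → T (ix (proj₁ y) t) → (w : Fin N → Vertex N) →
                   (∀ i → Adj y (w i)) → (∀ {i j} → w i ≡ w j → i ≡ j) → ⊥
    degree-bound y t yt w adj w-injective = Finₚ.<-irrefl i≡j i<j
      where
      flip : ∀ i → ∃ λ k → k < N × Flip k (proj₁ y) (proj₁ (w i))
      flip i = Adj⇒Flip y (w i) (adj i)
      pos : Fin N → Fin N
      pos i = fromℕ< (proj₁ (proj₂ (flip i)))
      pos-injective : ∀ {i j} → pos i ≡ pos j → i ≡ j
      pos-injective {i} {j} e = w-injective (vertex-≡ (Flip-functional {k = proj₁ (flip i)} {proj₁ y} (proj₂ (proj₂ (flip i))) flip-j))
        where
        same : proj₁ (flip j) ≡ proj₁ (flip i)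
        same = trans (sym (Finₚ.toℕ-fromℕ< _)) (trans (cong toℕ (sym e)) (Finₚ.toℕ-fromℕ< _))
        flip-j : Flip (proj₁ (flip i)) (proj₁ y) (proj₁ (w j))
        flip-j = subst (λ k → Flip k (proj₁ y) (proj₁ (w j))) same (proj₂ (proj₂ (flip j)))
      y-after-t : ix (proj₁ y) (suc t) ≡ false
      y-after-t with ix (proj₁ y) (suc t) in e
      ... | false = refl
      ... | true = ⊥-elim (noAdjacentOnes y t yt (Equivalence.from T-≡ e))
      after-t : Fin N
      after-t = (suc t) mod N
      avoids : ∀ i → after-t ≢ pos i
      avoids i e = noAdjacentOnes (w i) t
        (Equivalence.from T-≡ (trans (f t) (cong₂ _xor_ (≢ₘ⇒δ (i≢ₘi+1 t)) (Equivalence.to T-≡ yt))))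
        (Equivalence.from T-≡ (trans (f (suc t)) (cong₂ _xor_ (δ-refl {d} (suc t)) y-after-t)))
        where
        k≡t+1 : ModEq d (proj₁ (flip i)) (suc t)
        k≡t+1 = ≡ₘ-trans (≡ₘ-reflexive (trans (sym (Finₚ.toℕ-fromℕ< _)) (trans (cong toℕ (sym e)) (Finₚ.toℕ-fromℕ< _))))
                          (≡ₘ-% (suc t))
        f : Flip (suc t) (proj₁ y) (proj₁ (w i))
        f = Flip-≡ₘ {u = proj₁ y} {v = proj₁ (w i)} k≡t+1 (proj₂ (proj₂ (flip i)))
      squeeze : Fin N → Fin d
      squeeze i = punchOut (avoids i)
      collision = Finₚ.pigeonhole (n<1+n d) squeeze
      i = proj₁ collision
      j = proj₁ (proj₂ collision)
      i<j = proj₁ (proj₂ (proj₂ collision))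
      i≡j : i ≡ j
      i≡j = pos-injective (Finₚ.punchOut-injective (avoids i) (avoids j) (proj₂ (proj₂ (proj₂ collision))))

    -- σ 0 has the N distinct neighbours σ eᵢ, so it has no 1
    zero-fixed : (σ : Aut N) → apply σ zeroV ≡ zeroV
    zero-fixed σ with Finₚ.any? (λ t → T? (ix (proj₁ (apply σ zeroV)) (toℕ t)))
    ... | yes (t , yt) = ⊥-elim (degree-bound (apply σ zeroV) (toℕ t) yt (λ i → apply σ (unitV (toℕ i)))
            (λ i → apply-Adj σ _ _ (Adj-zero-unit (toℕ i)))
            (λ {i} {j} e → Finₚ.toℕ-injective (≡ₘ⇒≡ (Finₚ.toℕ<n i) (Finₚ.toℕ<n j)
                             (unit-injective {d} (cong proj₁ (apply-injective σ e))))))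
    ... | no none = only-zeros⇒zeroV (apply σ zeroV) λ t t<N → ¬T⇒false (λ yt →
            none (fromℕ< t<N , subst (λ s → T (ix (proj₁ (apply σ zeroV)) s)) (sym (Finₚ.toℕ-fromℕ< t<N)) yt))
      where
      ¬T⇒false : ∀ {b} → ¬ T b → b ≡ false
      ¬T⇒false {false} _ = refl
      ¬T⇒false {true} h = ⊥-elim (h tt)

    opaque
      unit-image : (σ : Aut N) → ∀ k → ∃ λ k' → k' < N × apply σ (unitV k) ≡ unitV k'
      unit-image σ k = zero-neighbour (apply σ (unitV k))
        (subst (λ w → Adj w (apply σ (unitV k))) (zero-fixed σ) (apply-Adj σ zeroV (unitV k) (Adj-zero-unit k)))

module CommonNeighbours where
  open Modular
  open CyclicStrings
  open Automorphisms
  open Adjacency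
  open UnitVectors
  open ZeroIsFixed

  -- Units eₐ, e_b (a ≢ b) have a nonzero common neighbour, namely eₐ + e_b,
  -- exactly when a and b are not cyclically consecutive.  This lets an
  -- automorphism fixing 0 be read as a symmetry of the cycle of positions.
  module _ {d : ℕ} (1≤d : 1 ≤ d) where
    private
      N = suc d
      V = Vec Bool N
      e = unitV 1≤d

    OnlyZeroInCommon : ℕ → ℕ → Set
    OnlyZeroInCommon a b = ∀ (y : Vertex N) → Adj y (e a) → Adj y (e b) → proj₁ y ≡ zeros {d}

    neighbour-of-unit : ∀ {a} (y : Vertex N) → Adj y (e a) → ∃ λ k → Flip k (unit {d} a) (proj₁ y)
    neighbour-of-unit {a} y adj with Adj⇒Flip y (e a) adj
    ... | k , _ , f = k , Flip-sym {d} {k} {proj₁ y} {unit a} f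

    unit-step : ∀ i j → ix (unit {d} (suc i)) j ≡ δ {d} j i xor (δ {d} j (suc i) xor ix (unit {d} i) j)
    unit-step i j = trans (ix-unit {d} (suc i) j)
      (sym (trans (cong (λ x → δ {d} j i xor (δ {d} j (suc i) xor x)) (ix-unit {d} i j)) (xor-cancelʳ (δ j i) (δ j (suc i)))))

    -- consecutive units have only 0 in common: a common neighbour is eᵢ
    -- with i or i+1 flipped, i.e. 0 or a string with two adjacent 1s
    consecutive-units : ∀ i → OnlyZeroInCommon i (suc i)
    consecutive-units i y adjᵢ adjᵢ₊₁ with neighbour-of-unit {i} y adjᵢ | neighbour-of-unit {suc i} y adjᵢ₊₁
    ... | k₁ , f₁ | k₂ , f₂ with common-neighbour-flip {d} {k₁} {k₂} {i} {suc i} {unit i} {unit (suc i)} {proj₁ y}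
                                   (i≢ₘi+1 1≤d i) f₁ f₂ (unit-step i)
    -- flipping position i of eᵢ gives 0
    ... | inj₁ k₁≡i = ix-ext λ j → trans (Flip-≡ₘ {d} {k₁} {i} {unit i} {proj₁ y} k₁≡i f₁ j)
        (trans (cong (δ j i xor_) (ix-unit {d} i j)) (trans (xor-same (δ j i)) (sym (ix-zeros {d} j))))
    -- flipping position i+1 of eᵢ gives two adjacent 1s
    ... | inj₂ k₁≡i+1 = ⊥-elim (noAdjacentOnes y i yᵢ yᵢ₊₁)
      where
      f = Flip-≡ₘ {d} {k₁} {suc i} {unit i} {proj₁ y} k₁≡i+1 f₁
      yᵢ : T (ix (proj₁ y) i)
      yᵢ = Equivalence.from T-≡ (trans (f i)
             (trans (cong₂ _xor_ (≢ₘ⇒δ {d} {i} {suc i} (i≢ₘi+1 1≤d i)) (ix-unit {d} i i)) (δ-refl {d} i)))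
      yᵢ₊₁ : T (ix (proj₁ y) (suc i))
      yᵢ₊₁ = Equivalence.from T-≡ (trans (f (suc i)) (trans (cong₂ _xor_ (δ-refl {d} (suc i)) (ix-unit {d} i (suc i)))
               (cong not (≢ₘ⇒δ {d} {suc i} {i} (λ c → i≢ₘi+1 1≤d i (≡ₘ-sym c))))))

    pair : ℕ → ℕ → V
    pair a b = tab (λ j → δ {d} j b xor δ {d} j a)

    ix-pair : ∀ a b i → ix (pair a b) i ≡ δ i b xor δ i a
    ix-pair a b i = trans (ix-tab {d} (λ j → δ {d} j b xor δ {d} j a) i)
      (cong₂ _xor_ (δ-respˡ {d} {k = b} (≡ₘ-% i)) (δ-respˡ {d} {k = a} (≡ₘ-% i)))

    -- otherwise eₐ + e_b is a Lucas string adjacent to both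
    distant-units : ∀ {a b} → ¬ ModEq d a b → ¬ ModEq d (suc a) b → ¬ ModEq d (suc b) a → ¬ OnlyZeroInCommon a b
    distant-units {a} {b} a≢b a+1≢b b+1≢a only = false≢true (begin
      false                   ≡⟨ ix-zeros {d} a ⟨
      ix (zeros {d}) a        ≡⟨ ix-cong (only pairV adj-a adj-b) a ⟨
      ix (pair a b) a         ≡⟨ ix-pair a b a ⟩
      δ a b xor δ a a         ≡⟨ cong₂ _xor_ (≢ₘ⇒δ a≢b) (δ-refl a) ⟩
      true                    ∎)
      where
      open ≡-Reasoning
      one-at : ∀ i → T (ix (pair a b) i) → ModEq d i b ⊎ ModEq d i a
      one-at i t with δ {d} i b in eb | δ {d} i a in ea
      ... | true | _ = inj₁ (δ⇒≡ₘ (Equivalence.from T-≡ eb))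
      ... | false | true = inj₂ (δ⇒≡ₘ (Equivalence.from T-≡ ea))
      ... | false | false = ⊥-elim (subst T (trans (ix-pair a b i) (cong₂ _xor_ eb ea)) t)
      step : ∀ {i x y} → ModEq d i x → ModEq d (suc i) y → ModEq d (suc x) y
      step {i} p q = ≡ₘ-trans (≡ₘ-+ (≡ₘ-refl {a = 1}) (≡ₘ-sym p)) q
      free : NoAdjacentOnes (pair a b)
      free i t₁ t₂ with one-at i t₁ | one-at (suc i) t₂
      ... | inj₁ p | inj₁ q = i≢ₘi+1 1≤d i (≡ₘ-trans p (≡ₘ-sym q))
      ... | inj₁ p | inj₂ q = b+1≢a (step p q)
      ... | inj₂ p | inj₁ q = a+1≢b (step p q)
      ... | inj₂ p | inj₂ q = i≢ₘi+1 1≤d i (≡ₘ-trans p (≡ₘ-sym q))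
      pairV : Vertex N
      pairV = pair a b , noAdjacentOnes⇒lucas (pair a b) free
      adj-a : Adj pairV (e a)
      adj-a = Adj-sym (e a) pairV (Flip⇒Adj (e a) pairV b (λ j →
                trans (ix-pair a b j) (cong (δ j b xor_) (sym (ix-unit {d} a j)))))
      adj-b : Adj pairV (e b)
      adj-b = Adj-sym (e b) pairV (Flip⇒Adj (e b) pairV a (λ j →
                trans (ix-pair a b j) (trans (xor-comm (δ j b) (δ j a)) (cong (δ j a xor_) (sym (ix-unit {d} b j))))))

    onlyZeroInCommon⇒close : ∀ {a b} → OnlyZeroInCommon a b → ModEq d a b ⊎ ModEq d (suc a) b ⊎ ModEq d (suc b) a
    onlyZeroInCommon⇒close {a} {b} only with a ≡ₘ? b | suc a ≡ₘ? b | suc b ≡ₘ? a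
    ... | yes p | _ | _ = inj₁ p
    ... | no _ | yes p | _ = inj₂ (inj₁ p)
    ... | no _ | no _ | yes p = inj₂ (inj₂ p)
    ... | no p | no q | no r = ⊥-elim (distant-units p q r only)

    OnlyZeroInCommon-transport : (σ : Aut N) → apply σ zeroV ≡ zeroV → ∀ {a b a' b'} →
      apply σ (e a) ≡ e a' → apply σ (e b) ≡ e b' → OnlyZeroInCommon a b → OnlyZeroInCommon a' b'
    OnlyZeroInCommon-transport σ σ0 {a} {b} σa σb only y' adj-a adj-b = begin
      proj₁ y'                       ≡⟨ cong proj₁ (apply-unapply σ y') ⟨
      proj₁ (apply σ y)              ≡⟨ cong (λ w → proj₁ (apply σ w)) (vertex-≡ {x = y} {y = zeroV} (only y adj-a' adj-b')) ⟩
      proj₁ (apply σ zeroV)          ≡⟨ cong proj₁ σ0 ⟩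
      zeros                          ∎
      where
      open ≡-Reasoning
      y = unapply σ y'
      adj-a' : Adj y (e a)
      adj-a' = apply-Adj⁻ σ y (e a) (subst₂ Adj (sym (apply-unapply σ y')) (sym σa) adj-a)
      adj-b' : Adj y (e b)
      adj-b' = apply-Adj⁻ σ y (e b) (subst₂ Adj (sym (apply-unapply σ y')) (sym σb) adj-b)

module Reconstruction where
  open Modular
  open CyclicStrings
  open Automorphisms
  open Adjacency
  open UnitVectors
  open ZeroIsFixed

  -- The key step:
  -- a vertex x with 1s at positions s ≢ t is determined, among the common
  -- neighbours of x with t cleared and x with s cleared, by avoiding x with
  -- both cleared.  Induction on the support then finishes the argument.
  module _ {d : ℕ} where
    private
      N = suc d
      V = Vec Bool N

    clear : ℕ → V → V
    clear k v = tab (λ j → not (δ {d} j k) ∧ ix v j)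

    ix-clear : ∀ k v i → ix (clear k v) i ≡ not (δ {d} i k) ∧ ix v i
    ix-clear k v i = trans (ix-tab {d} (λ j → not (δ {d} j k) ∧ ix v j) i)
      (cong₂ (λ a b → not a ∧ b) (δ-respˡ {d} {k = k} (≡ₘ-% i)) (ix-≡ₘ v (≡ₘ-% i)))

    noAdjacentOnes-clear : ∀ k v → NoAdjacentOnes v → NoAdjacentOnes (clear k v)
    noAdjacentOnes-clear k v free i a b =
      free i (proj₂ (Equivalence.to T-∧ (subst T (ix-clear k v i) a))) (proj₂ (Equivalence.to T-∧ (subst T (ix-clear k v (suc i)) b)))

    Flip-clear : ∀ k v → ix v k ≡ true → Flip k (clear k v) v
    Flip-clear k v vk j with δ {d} j k in eq
    ... | true = trans (trans (ix-≡ₘ v (δ⇒≡ₘ {d} {j} {k} (Equivalence.from T-≡ eq))) vk)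
                   (cong not (sym (trans (ix-clear k v j) (cong (λ a → not a ∧ ix v j) eq))))
    ... | false = sym (trans (ix-clear k v j) (cong (λ a → not a ∧ ix v j) eq))

    clear-swap : ∀ {t s} v → ¬ ModEq d t s → ix v t ≡ true → ix v s ≡ true →
                 ∀ j → ix (clear s v) j ≡ δ j t xor (δ j s xor ix (clear t v) j)
    clear-swap {t} {s} v t≢s vt vs j = trans (ix-clear s v j)
      (trans (bits (δ j t) (δ j s) (ix v j) (one-at t vt) (one-at s vs) distinct)
             (cong (λ a → δ j t xor (δ j s xor a)) (sym (ix-clear t v j))))
      where
      bits : ∀ bt bs x → (bt ≡ true → x ≡ true) → (bs ≡ true → x ≡ true) → (bt ≡ true → bs ≡ false) →
             not bs ∧ x ≡ bt xor (bs xor (not bt ∧ x))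
      bits true bs x h₁ h₂ h₃ rewrite h₁ refl | h₃ refl = refl
      bits false true x h₁ h₂ h₃ rewrite h₂ refl = refl
      bits false false x h₁ h₂ h₃ = refl
      one-at : ∀ k → ix v k ≡ true → δ j k ≡ true → ix v j ≡ true
      one-at k vk jk = trans (ix-≡ₘ v (δ⇒≡ₘ {d} {j} {k} (Equivalence.from T-≡ jk))) vk
      distinct : δ j t ≡ true → δ j s ≡ false
      distinct jt = ≢ₘ⇒δ {d} {j} {s} (λ js → t≢s (≡ₘ-trans (≡ₘ-sym (δ⇒≡ₘ {d} {j} {t} (Equivalence.from T-≡ jt))) js))

  module _ {d : ℕ} (1≤d : 1 ≤ d) where
    private
      N = suc d
      V = Vec Bool N

    clearV : ℕ → Vertex N → Vertex N
    clearV k x = clear k (proj₁ x) , noAdjacentOnes⇒lucas (clear k (proj₁ x)) (noAdjacentOnes-clear k (proj₁ x) (noAdjacentOnes x))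

    fixed-from-clearings : (τ : Aut N) (x : Vertex N) {t s : ℕ} → ¬ ModEq d t s →
      ix (proj₁ x) t ≡ true → ix (proj₁ x) s ≡ true →
      apply τ (clearV t x) ≡ clearV t x → apply τ (clearV s x) ≡ clearV s x →
      apply τ (clearV s (clearV t x)) ≡ clearV s (clearV t x) → apply τ x ≡ x
    fixed-from-clearings τ x {t} {s} t≢s xt xs τA τB τC = conclude
      (common-neighbour-flip {d} {k₁} {k₂} {t} {s} {proj₁ A} {proj₁ B} {proj₁ (apply τ x)}
        t≢s flip₁ flip₂ (clear-swap (proj₁ x) t≢s xt xs))
      where
      A = clearV t x
      B = clearV s x
      C = clearV s A
      -- x is a neighbour of its clearing p = clearV k x, so τx is a neighbour of τp = p
      image-flip : ∀ k → ix (proj₁ x) k ≡ true → apply τ (clearV k x) ≡ clearV k x →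
                   ∃ λ k' → Flip k' (proj₁ (clearV k x)) (proj₁ (apply τ x))
      image-flip k xk τp = proj₁ flip , Flip-sym {d} {proj₁ flip} {proj₁ (apply τ x)} {proj₁ (clearV k x)} (proj₂ (proj₂ flip))
        where
        adjacent : Adj (apply τ x) (clearV k x)
        adjacent = subst (Adj (apply τ x)) τp (apply-Adj τ x (clearV k x)
                     (Adj-sym (clearV k x) x (Flip⇒Adj (clearV k x) x k (Flip-clear k (proj₁ x) xk))))
        flip = Adj⇒Flip (apply τ x) (clearV k x) adjacent
      k₁ = proj₁ (image-flip t xt τA)
      flip₁ : Flip k₁ (proj₁ A) (proj₁ (apply τ x))
      flip₁ = proj₂ (image-flip t xt τA)
      k₂ = proj₁ (image-flip s xs τB)
      flip₂ : Flip k₂ (proj₁ B) (proj₁ (apply τ x))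
      flip₂ = proj₂ (image-flip s xs τB)
      As : ix (proj₁ A) s ≡ true
      As = trans (ix-clear t (proj₁ x) s) (cong₂ (λ a b → not a ∧ b) (≢ₘ⇒δ (λ e → t≢s (≡ₘ-sym e))) xs)
      conclude : ModEq d k₁ t ⊎ ModEq d k₁ s → apply τ x ≡ x
      -- τx is A with t flipped back, i.e. x
      conclude (inj₁ k₁≡t) = vertex-≡ (Flip-functional {d} {t} {proj₁ A}
        (Flip-≡ₘ {d} {k₁} {t} {proj₁ A} {proj₁ (apply τ x)} k₁≡t flip₁) (Flip-clear t (proj₁ x) xt))
      -- τx would be A with s cleared, i.e. C = τC, so x = C; but x has a 1 at s
      conclude (inj₂ k₁≡s) = ⊥-elim (false≢true (begin
        false            ≡⟨ trans (ix-clear s (proj₁ A) s) (cong (λ a → not a ∧ ix (proj₁ A) s) (δ-refl {d} s)) ⟨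
        ix (proj₁ C) s   ≡⟨ cong (λ w → ix (proj₁ w) s) x≡C ⟨
        ix (proj₁ x) s   ≡⟨ xs ⟩
        true             ∎))
        where
        open ≡-Reasoning
        τx≡C : apply τ x ≡ C
        τx≡C = vertex-≡ (Flip-functional {d} {s} {proj₁ A}
          (Flip-≡ₘ {d} {k₁} {s} {proj₁ A} {proj₁ (apply τ x)} k₁≡s flip₁)
          (Flip-sym {d} {s} {proj₁ C} {proj₁ A} (Flip-clear s (proj₁ A) As)))
        x≡C : x ≡ C
        x≡C = apply-injective τ (trans τx≡C (sym τC))

    SupportBelow : ℕ → Vertex N → Set
    SupportBelow t x = ∀ j → j < N → t ≤ j → ix (proj₁ x) j ≡ false

    -- Induction on the support: below t covers strings with all 1s below t;
    -- top t s covers strings with a 1 at t and the other 1s below s.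
    fixes-all : (τ : Aut N) → apply τ zeroV ≡ zeroV →
                (∀ i → i < N → apply τ (unitV 1≤d i) ≡ unitV 1≤d i) → ∀ x → apply τ x ≡ x
    fixes-all τ τz τe x = below N ≤-refl x (λ j j<N N≤j → ⊥-elim (<⇒≱ j<N N≤j))
      where
      Fixed : Vertex N → Set
      Fixed x = apply τ x ≡ x

      distinct : ∀ {i k} → i < N → k < N → i ≢ k → ¬ ModEq d i k
      distinct i<N k<N i≢k c = i≢k (≡ₘ⇒≡ i<N k<N c)

      top : ∀ t → t < N → (∀ x → SupportBelow t x → Fixed x) → ∀ s → s ≤ t → ∀ x →
            ix (proj₁ x) t ≡ true → (∀ j → j < N → s ≤ j → j ≢ t → ix (proj₁ x) j ≡ false) → Fixed x
      top t t<N below-t zero _ x xt rest = trans (cong (apply τ) x≡eₜ) (trans (τe t t<N) (sym x≡eₜ))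
        where
        x≡eₜ : x ≡ unitV 1≤d t
        x≡eₜ = vertex-≡ (ix-ext λ i → trans (ix-≡ₘ (proj₁ x) (≡ₘ-sym (≡ₘ-% i)))
          (trans (bit (i % N) (m%n<n i N)) (trans (δ-respˡ {d} {k = t} (≡ₘ-% i)) (sym (ix-unit {d} t i)))))
          where
          bit : ∀ j → j < N → ix (proj₁ x) j ≡ δ {d} j t
          bit j j<N with j ≟ t
          ... | yes refl = trans xt (sym (δ-refl {d} j))
          ... | no j≢t = trans (rest j j<N z≤n j≢t) (sym (≢ₘ⇒δ (distinct j<N t<N j≢t)))
      top t t<N below-t (suc s) s<t x xt rest with ix (proj₁ x) s in xs
      ... | false = top t t<N below-t s (<⇒≤ s<t) x xt λ j j<N s≤j j≢t → case m≤n⇒m<n∨m≡n s≤j of λ where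
            (inj₁ s<j) → rest j j<N s<j j≢t
            (inj₂ refl) → xs
      ... | true = fixed-from-clearings τ x (λ c → s≢t (sym (≡ₘ⇒≡ t<N s<N c))) xt xs
                     (below-t A A-below) (top t t<N below-t s (<⇒≤ s<t) B Bt B-rest)
                     (below-t C (λ j j<N t≤j → trans (ix-clear s (proj₁ A) j)
                       (trans (cong (not (δ j s) ∧_) (A-below j j<N t≤j)) (∧-zeroʳ _))))
        where
        s<N : s < N
        s<N = <-trans s<t t<N
        s≢t : s ≢ t
        s≢t = <⇒≢ s<t
        A = clearV t x
        B = clearV s x
        C = clearV s A
        A-below : SupportBelow t A
        A-below j j<N t≤j = trans (ix-clear t (proj₁ x) j) (case m≤n⇒m<n∨m≡n t≤j of λ where
          (inj₁ t<j) → trans (cong (not (δ j t) ∧_) (rest j j<N (≤-trans s<t (<⇒≤ t<j)) (λ e → <-irrefl (sym e) t<j))) (∧-zeroʳ _)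
          (inj₂ refl) → cong (λ a → not a ∧ ix (proj₁ x) t) (δ-refl {d} t))
        Bt : ix (proj₁ B) t ≡ true
        Bt = trans (ix-clear s (proj₁ x) t) (cong₂ (λ a b → not a ∧ b) (≢ₘ⇒δ (distinct t<N s<N (λ e → s≢t (sym e)))) xt)
        B-rest : ∀ j → j < N → s ≤ j → j ≢ t → ix (proj₁ B) j ≡ false
        B-rest j j<N s≤j j≢t = trans (ix-clear s (proj₁ x) j) (case m≤n⇒m<n∨m≡n s≤j of λ where
          (inj₁ s<j) → trans (cong (not (δ j s) ∧_) (rest j j<N s<j j≢t)) (∧-zeroʳ _)
          (inj₂ refl) → cong (λ a → not a ∧ ix (proj₁ x) s) (δ-refl {d} s))

      below : ∀ t → t ≤ N → ∀ x → SupportBelow t x → Fixed x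
      below zero _ x x-below = trans (cong (apply τ) x≡0) (trans τz (sym x≡0))
        where
        x≡0 : x ≡ zeroV
        x≡0 = only-zeros⇒zeroV 1≤d x (λ t t<N → x-below t t<N z≤n)
      below (suc t) t<N x x-below with ix (proj₁ x) t in xt
      ... | false = below t (<⇒≤ t<N) x λ j j<N t≤j → case m≤n⇒m<n∨m≡n t≤j of λ where
            (inj₁ t<j) → x-below j j<N t<j
            (inj₂ refl) → xt
      ... | true = top t t<N (below t (<⇒≤ t<N)) t ≤-refl x xt
                     (λ j j<N t≤j j≢t → x-below j j<N (≤∧≢⇒< t≤j (λ e → j≢t (sym e))))

module Rigidity where
  open Modular
  open CyclicStrings
  open Automorphisms
  open Adjacency
  open Dihedral
  open UnitVectors
  open ZeroIsFixed
  open CommonNeighbours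
  open Reconstruction

  -- Every automorphism agrees with a dihedral symmetry: composing with a
  -- rotation and possibly the reflection we may assume it fixes 0, e₀, e₁;
  -- then it fixes every unit (consecutive units stay consecutive), and then
  -- every vertex (a vertex is pinned down by its neighbours of smaller support).
  module _ {d : ℕ} (1≤d : 1 ≤ d) where
    private
      N = suc d
      V = Vec Bool N
      z = zeroV
      e = unitV 1≤d

    FixesBase : Aut N → Set
    FixesBase τ = apply τ z ≡ z × apply τ (e 0) ≡ e 0 × apply τ (e 1) ≡ e 1

    unitV-≡ₘ : ∀ {k l} → ModEq d k l → e k ≡ e l
    unitV-≡ₘ c = vertex-≡ (unit-≡ₘ {d} c)

    unitV-injective : ∀ (τ : Aut N) {k l k'} → apply τ (e k) ≡ e k' → apply τ (e l) ≡ e k' → ModEq d k l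
    unitV-injective τ τk τl = unit-injective {d} (cong proj₁ (apply-injective τ (trans τk (sym τl))))

    -- σ e₀ = eⱼ; after rotating by j, e₁ goes to a unit consecutive to e₀,
    -- i.e. e₁ or e₋₁ = e_d, and in the latter case we also reflect
    normalise : (σ : Aut N) → ∃ λ j → FixesBase (rotᴬ j ∘ᴬ σ) ⊎ FixesBase (refᴬ ∘ᴬ (rotᴬ j ∘ᴬ σ))
    normalise σ = j , by-cases (onlyZeroInCommon⇒close 1≤d {0} {k} only-0k)
      where
      j = proj₁ (unit-image 1≤d σ 0)
      σe₀ : apply σ (e 0) ≡ e j
      σe₀ = proj₂ (proj₂ (unit-image 1≤d σ 0))
      τ = rotᴬ j ∘ᴬ σ
      τz : apply τ z ≡ z
      τz = trans (cong (rotV j) (zero-fixed 1≤d σ)) (vertex-≡ (rot-zeros {d} j))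
      τe₀ : apply τ (e 0) ≡ e 0
      τe₀ = trans (cong (rotV j) σe₀) (vertex-≡ (trans (rot-unit {d} j j) (unit-≡ₘ {d} (c+d*c≡ₘ0 j))))
      k = proj₁ (unit-image 1≤d τ 1)
      τe₁ : apply τ (e 1) ≡ e k
      τe₁ = proj₂ (proj₂ (unit-image 1≤d τ 1))
      only-0k : OnlyZeroInCommon 1≤d 0 k
      only-0k = OnlyZeroInCommon-transport 1≤d τ τz {0} {1} {0} {k} τe₀ τe₁ (consecutive-units 1≤d 0)
      by-cases : ModEq d 0 k ⊎ ModEq d 1 k ⊎ ModEq d (suc k) 0 → FixesBase τ ⊎ FixesBase (refᴬ ∘ᴬ τ)
      by-cases (inj₁ 0≡k) = ⊥-elim (i≢ₘi+1 1≤d 0 (unitV-injective τ {0} {1} {k} (trans τe₀ (unitV-≡ₘ {0} {k} 0≡k)) τe₁))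
      by-cases (inj₂ (inj₁ 1≡k)) = inj₁ (τz , τe₀ , trans τe₁ (unitV-≡ₘ {k} {1} (≡ₘ-sym 1≡k)))
      by-cases (inj₂ (inj₂ k+1≡0)) = inj₂ (trans (cong refV τz) (vertex-≡ (ref-zeros {d})) ,
                                           trans (cong refV τe₀) (vertex-≡ (trans (ref-unit {d} 0) (unit-≡ₘ {d} (≡ₘ-reflexive (*-zeroʳ d))))) ,
                                           trans (cong refV τe₁) (vertex-≡ (trans (ref-unit {d} k) (unit-≡ₘ {d} -k≡1))))
        where
        -- k ≡ -1, so -k ≡ 1
        k≡d : ModEq d k d
        k≡d = ≡ₘ-cancelʳ {c = 1} (≡ₘ-trans (≡ₘ-reflexive (+-comm k 1))
                (≡ₘ-trans k+1≡0 (≡ₘ-trans (≡ₘ-sym ≡ₘ-modulus) (≡ₘ-reflexive (+-comm 1 d)))))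
        -k≡1 : ModEq d (d * k) 1
        -k≡1 = ≡ₘ-trans (≡ₘ-* (≡ₘ-refl {a = d}) k≡d)
                 (≡ₘ-trans (≡ₘ-reflexive (cong (d *_) (sym (*-identityʳ d)))) (d*d*x≡ₘx 1))

    -- walking along the cycle of positions, consecutive units stay consecutive
    fixes-units : (τ : Aut N) → FixesBase τ → ∀ i → i < N → apply τ (e i) ≡ e i
    fixes-units τ (τz , τe₀ , τe₁) zero _ = τe₀
    fixes-units τ (τz , τe₀ , τe₁) (suc i) i+1<N = proj₂ (consecutive i i+1<N)
      where
      consecutive : ∀ i → suc i < N → apply τ (e i) ≡ e i × apply τ (e (suc i)) ≡ e (suc i)
      consecutive zero _ = τe₀ , τe₁
      consecutive (suc i) i+2<N = τeᵢ₊₁ , by-cases (onlyZeroInCommon⇒close 1≤d {suc i} {k} only)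
        where
        τeᵢ = proj₁ (consecutive i (<-trans (n<1+n _) i+2<N))
        τeᵢ₊₁ = proj₂ (consecutive i (<-trans (n<1+n _) i+2<N))
        k = proj₁ (unit-image 1≤d τ (suc (suc i)))
        τeᵢ₊₂ : apply τ (e (suc (suc i))) ≡ e k
        τeᵢ₊₂ = proj₂ (proj₂ (unit-image 1≤d τ (suc (suc i))))
        only : OnlyZeroInCommon 1≤d (suc i) k
        only = OnlyZeroInCommon-transport 1≤d τ τz {suc i} {suc (suc i)} {suc i} {k} τeᵢ₊₁ τeᵢ₊₂ (consecutive-units 1≤d (suc i))
        by-cases : ModEq d (suc i) k ⊎ ModEq d (suc (suc i)) k ⊎ ModEq d (suc k) (suc i) → apply τ (e (suc (suc i))) ≡ e (suc (suc i))
        by-cases (inj₁ i+1≡k) = ⊥-elim (i≢ₘi+1 1≤d (suc i)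
          (unitV-injective τ {suc i} {suc (suc i)} {k} (trans τeᵢ₊₁ (unitV-≡ₘ {suc i} {k} i+1≡k)) τeᵢ₊₂))
        by-cases (inj₂ (inj₁ i+2≡k)) = trans τeᵢ₊₂ (unitV-≡ₘ {k} {suc (suc i)} (≡ₘ-sym i+2≡k))
        by-cases (inj₂ (inj₂ k+1≡i+1)) = ⊥-elim (2≢ₘ0 (≡ₘ-cancelʳ {a = 2} {b = 0} {c = i}
                                          (unitV-injective τ {suc (suc i)} {i} {k} τeᵢ₊₂ (trans τeᵢ (unitV-≡ₘ {i} {k} (≡ₘ-sym k≡i))))))
          where
          k≡i : ModEq d k i
          k≡i = ≡ₘ-cancelʳ {c = 1} (≡ₘ-trans (≡ₘ-reflexive (+-comm k 1)) (≡ₘ-trans k+1≡i+1 (≡ₘ-reflexive (+-comm 1 i))))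
          2≢ₘ0 : ¬ ModEq d 2 0
          2≢ₘ0 c with ≡ₘ⇒≡ (≤-<-trans (s≤s (s≤s z≤n)) i+2<N) z<s c
          ... | ()

  DihedralOrbit : ∀ {d} → Vertex (suc d) → Vertex (suc d) → Set
  DihedralOrbit x w = ∃ λ c → w ≡ rotV c x ⊎ w ≡ rotV c (refV x)

  automorphism-is-dihedral : ∀ {d} (σ : Aut (suc d)) x → DihedralOrbit x (apply σ x)
  automorphism-is-dihedral {zero} σ x = 0 , inj₁ (single-vertex _ _)
    where
    single-vertex : (x y : Vertex 1) → x ≡ y
    single-vertex (false ∷ [] , _) (false ∷ [] , _) = vertex-≡ refl
  automorphism-is-dihedral {suc d} σ x = from-normal-form (normalise (s≤s z≤n) σ)
    where
    -- if τ = (ref ∘) rot j ∘ σ fixes x, then σ x = rot (-j) ((ref) x)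
    from-normal-form : (∃ λ j → FixesBase (s≤s z≤n) (rotᴬ j ∘ᴬ σ) ⊎ FixesBase (s≤s z≤n) (refᴬ ∘ᴬ (rotᴬ j ∘ᴬ σ))) →
                       DihedralOrbit x (apply σ x)
    from-normal-form (j , inj₁ base) = suc d * j , inj₁ (vertex-≡ (begin
      proj₁ (apply σ x)                            ≡⟨ rot-inverseˡ j (proj₁ (apply σ x)) ⟨
      rot (suc d * j) (rot j (proj₁ (apply σ x)))  ≡⟨ cong (rot (suc d * j)) (cong proj₁ τx≡x) ⟩
      rot (suc d * j) (proj₁ x)                    ∎))
      where
      open ≡-Reasoning
      τx≡x : apply (rotᴬ j ∘ᴬ σ) x ≡ x
      τx≡x = fixes-all (s≤s z≤n) (rotᴬ j ∘ᴬ σ) (proj₁ base) (fixes-units (s≤s z≤n) (rotᴬ j ∘ᴬ σ) base) x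
    from-normal-form (j , inj₂ base) = suc d * j , inj₂ (vertex-≡ (begin
      proj₁ (apply σ x)                                  ≡⟨ rot-inverseˡ j (proj₁ (apply σ x)) ⟨
      rot (suc d * j) (rot j (proj₁ (apply σ x)))        ≡⟨ cong (rot (suc d * j)) (ref-ref (rot j (proj₁ (apply σ x)))) ⟨
      rot (suc d * j) (ref (ref (rot j (proj₁ (apply σ x)))))  ≡⟨ cong (λ v → rot (suc d * j) (ref v)) (cong proj₁ τx≡x) ⟩
      rot (suc d * j) (ref (proj₁ x))                    ∎))
      where
      open ≡-Reasoning
      τx≡x : apply (refᴬ ∘ᴬ (rotᴬ j ∘ᴬ σ)) x ≡ x
      τx≡x = fixes-all (s≤s z≤n) (refᴬ ∘ᴬ (rotᴬ j ∘ᴬ σ)) (proj₁ base)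
               (fixes-units (s≤s z≤n) (refᴬ ∘ᴬ (rotᴬ j ∘ᴬ σ)) base) x

  dihedral⇒InOrbit : ∀ {d} (x w : Vertex (suc d)) → DihedralOrbit x w → InOrbit x w
  dihedral⇒InOrbit x w (c , inj₁ e) = rotᴬ c , sym e
  dihedral⇒InOrbit x w (c , inj₂ e) = rotᴬ c ∘ᴬ refᴬ , sym e

  InOrbit⇔DihedralOrbit : ∀ {d} (x w : Vertex (suc d)) → InOrbit x w ⇔ DihedralOrbit x w
  InOrbit⇔DihedralOrbit x w = mk⇔ (λ { (σ , e) → subst (DihedralOrbit x) e (automorphism-is-dihedral σ x) }) (dihedral⇒InOrbit x w)

module Periods where
  open Modular
  open CyclicStrings
  open Dihedral
  open Rigidity

  -- The dihedral orbit of x is determined by the rotation period p of its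
  -- string (a divisor of n) and its chirality: it has p elements if the
  -- reflection of x is a rotation of x, and 2p elements otherwise.

  least : (P : ℕ → Set) → (∀ i → Dec (P i)) → ∀ n → P n → ∃ λ m → m ≤ n × P m × (∀ i → i < m → ¬ P i)
  least P P? zero p0 = 0 , z≤n , p0 , λ i ()
  least P P? (suc n) pn with P? 0
  ... | yes p0 = 0 , z≤n , p0 , λ i ()
  ... | no ¬p0 with least (λ i → P (suc i)) (λ i → P? (suc i)) n pn
  ... | m , m≤n , pm , smaller = suc m , s≤s m≤n , pm , λ where
          zero _ → ¬p0
          (suc i) i<m → smaller i (s≤s⁻¹ i<m)

  module _ {d : ℕ} where
    private
      N = suc d
      V = Vec Bool N

    record MinimalPeriod (q : ℕ) (v : V) : Set where
      field
        periodic : rot (suc q) v ≡ v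
        minimal  : ∀ i → 1 ≤ i → i ≤ q → rot i v ≢ v
    open MinimalPeriod public

    rot-modulus : ∀ v → rot N v ≡ v
    rot-modulus v = rot-≡ₘ0 v (≡ₘ-modulus {d})

    -- every string has a minimal period, as rot N v = v
    minimal-period : ∀ v → ∃ λ q → MinimalPeriod q v
    minimal-period v with least (λ i → rot (suc i) v ≡ v) (λ i → ≡-dec _≟ᴮ_ (rot (suc i) v) v) d (rot-modulus v)
    ... | m , _ , pm , smaller = m , record { periodic = pm ; minimal = λ { (suc i) _ i≤m → smaller i i≤m } }

    module Period {q : ℕ} {v : V} (mp : MinimalPeriod q v) where
      p = suc q

      rot-+multiple : ∀ r k → rot (r + k * p) v ≡ rot r v
      rot-+multiple r zero = cong (λ t → rot t v) (+-identityʳ r)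
      rot-+multiple r (suc k) = begin
        rot (r + (p + k * p)) v      ≡⟨ cong (λ t → rot t v) (regroup r p (k * p)) ⟩
        rot (p + (r + k * p)) v      ≡⟨ rot-rot (r + k * p) p v ⟨
        rot (r + k * p) (rot p v)    ≡⟨ cong (rot (r + k * p)) (periodic mp) ⟩
        rot (r + k * p) v            ≡⟨ rot-+multiple r k ⟩
        rot r v                      ∎
        where
        open ≡-Reasoning
        regroup : ∀ r p x → r + (p + x) ≡ p + (r + x)
        regroup = solve-∀

      rot-%period : ∀ a → rot a v ≡ rot (a % p) v
      rot-%period a = trans (cong (λ t → rot t v) (m≡m%n+[m/n]*n a p)) (rot-+multiple (a % p) (a / p))

      below-period : ∀ a → a < p → rot a v ≡ v → a ≡ 0
      below-period zero _ _ = refl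
      below-period (suc a) a<p e = ⊥-elim (minimal mp (suc a) (s≤s z≤n) (s≤s⁻¹ a<p) e)

      period∣N : p ∣ N
      period∣N = m%n≡0⇒n∣m N p (below-period (N % p) (m%n<n N p) (trans (sym (rot-%period N)) (rot-modulus v)))

      rot-injective-below-period′ : ∀ {a b} → a ≤ b → b < p → rot b v ≡ rot a v → b ≡ a
      rot-injective-below-period′ {a} {b} a≤b b<p e = trans (sym (m∸n+n≡m a≤b)) (cong (_+ a)
        (below-period (b ∸ a) (≤-<-trans (m∸n≤m b a) b<p) (rot-injective a (begin
          rot a (rot (b ∸ a) v)   ≡⟨ rot-rot a (b ∸ a) v ⟩
          rot (b ∸ a + a) v       ≡⟨ cong (λ t → rot t v) (m∸n+n≡m a≤b) ⟩
          rot b v                 ≡⟨ e ⟩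
          rot a v                 ∎))))
        where open ≡-Reasoning

      rot-injective-below-period : ∀ {i j} → i < p → j < p → rot i v ≡ rot j v → i ≡ j
      rot-injective-below-period {i} {j} i<p j<p e with ≤-total i j
      ... | inj₁ i≤j = sym (rot-injective-below-period′ i≤j j<p (sym e))
      ... | inj₂ j≤i = rot-injective-below-period′ j≤i i<p e

module OrbitCounting where
  open CyclicStrings
  open Dihedral
  open Rigidity
  open Periods

  module _ {d : ℕ} where
    private
      N = suc d
      V = Vec Bool N

    minimalPeriod-ref : ∀ {q v} → MinimalPeriod q v → MinimalPeriod q (ref v)
    minimalPeriod-ref {q} {v} mp = record { periodic = periodic′ ; minimal = minimal′ }
      where
      periodic′ : rot (suc q) (ref v) ≡ ref v
      periodic′ = trans (rot-ref (suc q) v) (cong ref (trans (Period.rot-+multiple mp 0 d) (rot-0 v)))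
      minimal′ : ∀ i → 1 ≤ i → i ≤ q → rot i (ref v) ≢ ref v
      minimal′ i 1≤i i≤q e = minimal mp i 1≤i i≤q (begin
        rot i v                   ≡⟨ cong (rot i) (ref-injective {d} {rot (d * i) v} {v} (trans (sym (rot-ref i v)) e)) ⟨
        rot i (rot (d * i) v)     ≡⟨ rot-inverseʳ i v ⟩
        v                         ∎)
        where open ≡-Reasoning

    Achiral : V → Set
    Achiral v = ∃ λ c → ref v ≡ rot c v

    -- chirality is decidable: only rotations below the period need checking
    achiral? : ∀ {q v} → MinimalPeriod q v → Dec (Achiral v)
    achiral? {q} {v} mp with Finₚ.any? {P = λ (c : Fin (suc q)) → ref v ≡ rot (toℕ c) v} (λ c → ≡-dec _≟ᴮ_ (ref v) (rot (toℕ c) v))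
    ... | yes (c , e) = yes (toℕ c , e)
    ... | no none = no λ { (c , e) → none (fromℕ< (m%n<n c (suc q)) ,
            trans e (trans (Period.rot-%period mp c) (cong (λ t → rot t v) (sym (Finₚ.toℕ-fromℕ< (m%n<n c (suc q))))))) }

    DihedralOrbitOfSize : Vertex N → ℕ → Set
    DihedralOrbitOfSize x k = ∃ λ (xs : List (Vertex N)) → Unique xs × length xs ≡ k × (∀ w → w ∈ xs ⇔ DihedralOrbit x w)

    rotations : (x : Vertex N) (q : ℕ) → List (Vertex N)
    rotations x q = List.tabulate {n = suc q} (λ i → rotV (toℕ i) x)

    rotations-unique : ∀ (x : Vertex N) q → MinimalPeriod q (proj₁ x) → Unique (rotations x q)
    rotations-unique x q mp = tabulate⁺ {f = λ i → rotV (toℕ i) x} λ {i} {j} e →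
      Finₚ.toℕ-injective (Period.rot-injective-below-period mp (Finₚ.toℕ<n i) (Finₚ.toℕ<n j) (cong proj₁ e))

    rotations-length : ∀ (x : Vertex N) q → length (rotations x q) ≡ suc q
    rotations-length x q = length-tabulate {n = suc q} (λ i → rotV (toℕ i) x)

    ∈-rotations : ∀ (x : Vertex N) q → MinimalPeriod q (proj₁ x) → ∀ c → rotV c x ∈ rotations x q
    ∈-rotations x q mp c = subst (_∈ rotations x q)
      (vertex-≡ (trans (cong (λ t → rot t (proj₁ x)) (Finₚ.toℕ-fromℕ< (m%n<n c (suc q)))) (sym (Period.rot-%period mp c))))
      (∈-tabulate⁺ {f = λ i → rotV (toℕ i) x} (fromℕ< (m%n<n c (suc q))))

    ∈-rotations⁻ : ∀ (x : Vertex N) q {w} → w ∈ rotations x q → ∃ λ c → w ≡ rotV c x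
    ∈-rotations⁻ x q m with ∈-tabulate⁻ {f = λ i → rotV (toℕ i) x} m
    ... | i , e = toℕ i , e

    achiral-orbit : ∀ (x : Vertex N) q → MinimalPeriod q (proj₁ x) → Achiral (proj₁ x) → DihedralOrbitOfSize x (suc q)
    achiral-orbit x q mp (c₀ , ref≡rot) = rotations x q , rotations-unique x q mp , rotations-length x q , λ w → mk⇔ (to w) (from w)
      where
      to : ∀ w → w ∈ rotations x q → DihedralOrbit x w
      to w m = let (c , e) = ∈-rotations⁻ x q m in c , inj₁ e
      from : ∀ w → DihedralOrbit x w → w ∈ rotations x q
      from w (c , inj₁ refl) = ∈-rotations x q mp c
      from w (c , inj₂ refl) = subst (_∈ rotations x q)
        (vertex-≡ (trans (sym (rot-rot c c₀ (proj₁ x))) (cong (rot c) (sym ref≡rot)))) (∈-rotations x q mp (c₀ + c))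

    chiral-orbit : ∀ (x : Vertex N) q → MinimalPeriod q (proj₁ x) → ¬ Achiral (proj₁ x) → DihedralOrbitOfSize x (suc q + suc q)
    chiral-orbit x q mp chiral =
      rotations x q ++ rotations (refV x) q ,
      ++⁺ (rotations-unique x q mp) (rotations-unique (refV x) q (minimalPeriod-ref mp)) disjoint ,
      trans (length-++ (rotations x q)) (cong₂ _+_ (rotations-length x q) (rotations-length (refV x) q)) ,
      λ w → mk⇔ (to w) (from w)
      where
      -- a common element would exhibit ref x as a rotation of x
      disjoint : ∀ {w} → ¬ (w ∈ rotations x q × w ∈ rotations (refV x) q)
      disjoint (m₁ , m₂) = chiral (i + d * j , (begin
        ref (proj₁ x)                         ≡⟨ rot-inverseˡ j (ref (proj₁ x)) ⟨
        rot (d * j) (rot j (ref (proj₁ x)))   ≡⟨ cong (rot (d * j)) rotations-meet ⟩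
        rot (d * j) (rot i (proj₁ x))         ≡⟨ rot-rot (d * j) i (proj₁ x) ⟩
        rot (i + d * j) (proj₁ x)             ∎))
        where
        open ≡-Reasoning
        i = proj₁ (∈-rotations⁻ x q m₁)
        j = proj₁ (∈-rotations⁻ (refV x) q m₂)
        rotations-meet : rot j (ref (proj₁ x)) ≡ rot i (proj₁ x)
        rotations-meet = cong proj₁ (trans (sym (proj₂ (∈-rotations⁻ (refV x) q m₂))) (proj₂ (∈-rotations⁻ x q m₁)))
      to : ∀ w → w ∈ rotations x q ++ rotations (refV x) q → DihedralOrbit x w
      to w m = either (∈-++⁻ (rotations x q) m)
        where
        either : w ∈ rotations x q ⊎ w ∈ rotations (refV x) q → DihedralOrbit x w
        either (inj₁ m₁) = proj₁ (∈-rotations⁻ x q m₁) , inj₁ (proj₂ (∈-rotations⁻ x q m₁))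
        either (inj₂ m₂) = proj₁ (∈-rotations⁻ (refV x) q m₂) , inj₂ (proj₂ (∈-rotations⁻ (refV x) q m₂))
      from : ∀ w → DihedralOrbit x w → w ∈ rotations x q ++ rotations (refV x) q
      from w (c , inj₁ refl) = ∈-++⁺ˡ (∈-rotations x q mp c)
      from w (c , inj₂ refl) = ∈-++⁺ʳ (rotations x q) (∈-rotations (refV x) q (minimalPeriod-ref mp) c)

    unique-lists-same-length : ∀ {A : Set} {xs ys : List A} → Unique xs → Unique ys → (∀ x → x ∈ xs ⇔ x ∈ ys) → length xs ≡ length ys
    unique-lists-same-length ux uy same = ↭-length (∼bag⇒↭ (unique∧set⇒bag ux uy (λ {x} → same x)))

    dihedralOrbitSize⇒IsOrbitSize : ∀ {k} → (∃ λ x → DihedralOrbitOfSize x k) → IsOrbitSize N k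
    dihedralOrbitSize⇒IsOrbitSize (x , xs , unique , len , members) = x , xs , unique , len , λ w →
      mk⇔ (λ m → Equivalence.from (InOrbit⇔DihedralOrbit x w) (Equivalence.to (members w) m))
          (λ o → Equivalence.from (members w) (Equivalence.to (InOrbit⇔DihedralOrbit x w) o))

    orbit-size-unique : ∀ {x k} (xs : List (Vertex N)) → Unique xs → (∀ w → w ∈ xs ⇔ InOrbit x w) →
                        DihedralOrbitOfSize x k → length xs ≡ k
    orbit-size-unique {x} xs unique members (ys , unique′ , len , members′) = trans
      (unique-lists-same-length unique unique′ λ w →
        mk⇔ (λ m → Equivalence.from (members′ w) (Equivalence.to (InOrbit⇔DihedralOrbit x w) (Equivalence.to (members w) m)))
            (λ m → Equivalence.from (members w) (Equivalence.from (InOrbit⇔DihedralOrbit x w) (Equivalence.to (members′ w) m))))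
      len

module ShortPeriods where
  open Modular
  open CyclicStrings
  open Dihedral
  open Periods
  open OrbitCounting

  -- A
  -- string of period p is determined by its first p letters, a cyclic Lucas
  -- word of length p, and for p ≤ 8 all such words are checked by computation.
  -- (The bound is sharp: see the chiral word of period 9 used for the witnesses.)

  allFin : ∀ n → (Fin n → Bool) → Bool
  allFin zero f = true
  allFin (suc n) f = f Fin.zero ∧ allFin n (λ i → f (Fin.suc i))

  anyFin : ∀ n → (Fin n → Bool) → Bool
  anyFin zero f = false
  anyFin (suc n) f = f Fin.zero ∨ anyFin n (λ i → f (Fin.suc i))

  allVec : ∀ n → (Vec Bool n → Bool) → Bool
  allVec zero f = f []
  allVec (suc n) f = allVec n (λ w → f (true ∷ w)) ∧ allVec n (λ w → f (false ∷ w))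

  allFin-sound : ∀ n {f : Fin n → Bool} → T (allFin n f) → ∀ i → T (f i)
  allFin-sound (suc n) t Fin.zero = proj₁ (Equivalence.to T-∧ t)
  allFin-sound (suc n) t (Fin.suc i) = allFin-sound n (proj₂ (Equivalence.to T-∧ t)) i

  allFin-complete : ∀ n {f : Fin n → Bool} → (∀ i → T (f i)) → T (allFin n f)
  allFin-complete zero h = tt
  allFin-complete (suc n) h = Equivalence.from T-∧ (h Fin.zero , allFin-complete n (λ i → h (Fin.suc i)))

  anyFin-sound : ∀ n {f : Fin n → Bool} → T (anyFin n f) → ∃ λ i → T (f i)
  anyFin-sound (suc n) {f} t with Equivalence.to T-∨ t
  ... | inj₁ t₀ = Fin.zero , t₀
  ... | inj₂ rest = let (i , tᵢ) = anyFin-sound n rest in Fin.suc i , tᵢ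

  allVec-sound : ∀ n {f : Vec Bool n → Bool} → T (allVec n f) → ∀ w → T (f w)
  allVec-sound zero t [] = t
  allVec-sound (suc n) t (true ∷ w) = allVec-sound n (proj₁ (Equivalence.to T-∧ t)) w
  allVec-sound (suc n) t (false ∷ w) = allVec-sound n (proj₂ (Equivalence.to T-∧ t)) w

  _==_ : Bool → Bool → Bool
  a == b = not (a xor b)

  ==-sound : ∀ {a b} → T (a == b) → a ≡ b
  ==-sound {true} {true} _ = refl
  ==-sound {false} {false} _ = refl

  module _ (q : ℕ) (W : Vec Bool (suc q)) where
    at′ : ℕ → Bool
    at′ t = lookup W (t mod suc q)

    noAdjacentOnesᵇ : Bool
    noAdjacentOnesᵇ = allFin (suc q) (λ t → not (lookup W t ∧ at′ (suc (toℕ t))))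

    -- the rotation by c of W equals its reflection t ↦ q·t ≡ -t
    reflection-at : Fin (suc q) → Fin (suc q) → Bool
    reflection-at c t = at′ (q * toℕ t) == at′ (toℕ c + toℕ t)

    achiralᵇ : Bool
    achiralᵇ = anyFin (suc q) (λ c → allFin (suc q) (reflection-at c))

  shortWordsAchiral : ℕ → Bool
  shortWordsAchiral q = allVec (suc q) (λ W → not (noAdjacentOnesᵇ q W) ∨ achiralᵇ q W)

  shortWordsAchiral-holds : ∀ q → q < 8 → T (shortWordsAchiral q)
  shortWordsAchiral-holds 0 _ = tt
  shortWordsAchiral-holds 1 _ = tt
  shortWordsAchiral-holds 2 _ = tt
  shortWordsAchiral-holds 3 _ = tt
  shortWordsAchiral-holds 4 _ = tt
  shortWordsAchiral-holds 5 _ = tt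
  shortWordsAchiral-holds 6 _ = tt
  shortWordsAchiral-holds 7 _ = tt
  shortWordsAchiral-holds (suc (suc (suc (suc (suc (suc (suc (suc q)))))))) (s≤s (s≤s (s≤s (s≤s (s≤s (s≤s (s≤s (s≤s ()))))))))

  -- transfer to strings of period 1+q ≤ 8: the reflection of v is read off
  -- from its first 1+q letters, where the finite check applies
  short-period⇒achiral : ∀ {d} (v : Vec Bool (suc d)) q → q < 8 → MinimalPeriod q v → NoAdjacentOnes v → Achiral v
  short-period⇒achiral {d} v q q<8 mp free = toℕ c , ix-ext λ i → begin
    ix (ref v) i                     ≡⟨ ix-ref v i ⟩
    g (d * i)                        ≡⟨ g-≡ₚ (≡ₘ-* d≡q (≡ₘ-sym (≡ₘ-% i))) ⟩
    g (q * (i % p))                  ≡⟨ trans (g-%p (q * (i % p))) (cong (λ x → g ((q * x) % p)) (sym (toℕ-i i))) ⟩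
    g ((q * toℕ (i mod p)) % p)      ≡⟨ sym (lookupW-mod (q * toℕ (i mod p))) ⟩
    at′ q W (q * toℕ (i mod p))      ≡⟨ rotation-matches (i mod p) ⟩
    at′ q W (toℕ c + toℕ (i mod p))  ≡⟨ lookupW-mod (toℕ c + toℕ (i mod p)) ⟩
    g ((toℕ c + toℕ (i mod p)) % p)  ≡⟨ trans (cong (λ x → g ((toℕ c + x) % p)) (toℕ-i i)) (sym (g-%p (toℕ c + i % p))) ⟩
    g (toℕ c + i % p)                ≡⟨ g-≡ₚ (≡ₘ-+ (≡ₘ-refl {a = toℕ c}) (≡ₘ-% i)) ⟩
    g (toℕ c + i)                    ≡⟨ ix-rot (toℕ c) v i ⟨
    ix (rot (toℕ c) v) i             ∎
    where
    open ≡-Reasoning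
    p = suc q
    g : ℕ → Bool
    g = ix v
    g-%p : ∀ a → g a ≡ g (a % p)
    g-%p a = begin
      g a               ≡⟨ cong g (+-identityʳ a) ⟨
      g (a + 0)         ≡⟨ ix-rot a v 0 ⟨
      ix (rot a v) 0    ≡⟨ cong (λ w → ix w 0) (Period.rot-%period mp a) ⟩
      ix (rot (a % p) v) 0   ≡⟨ ix-rot (a % p) v 0 ⟩
      g (a % p + 0)     ≡⟨ cong g (+-identityʳ (a % p)) ⟩
      g (a % p)         ∎
    g-≡ₚ : ∀ {a b} → ModEq q a b → g a ≡ g b
    g-≡ₚ {a} {b} (modEq e) = trans (g-%p a) (trans (cong g e) (sym (g-%p b)))
    W : Vec Bool p
    W = tabulate (λ t → g (toℕ t))
    lookupW : ∀ t → lookup W t ≡ g (toℕ t)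
    lookupW t = lookup∘tabulate (λ t → g (toℕ t)) t
    lookupW-mod : ∀ a → at′ q W a ≡ g (a % p)
    lookupW-mod a = trans (lookupW (a mod p)) (cong g (Finₚ.toℕ-fromℕ< (m%n<n a p)))
    toℕ-i : ∀ i → toℕ (i mod p) ≡ i % p
    toℕ-i i = Finₚ.toℕ-fromℕ< (m%n<n i p)
    W-free : T (noAdjacentOnesᵇ q W)
    W-free = allFin-complete p {λ t → not (lookup W t ∧ at′ q W (suc (toℕ t)))} λ t → Equivalence.from T-not-≡ (helper t)
      where
      helper : ∀ t → (lookup W t ∧ at′ q W (suc (toℕ t))) ≡ false
      helper t with lookup W t in e₁ | at′ q W (suc (toℕ t)) in e₂
      ... | false | _ = refl
      ... | true | false = refl
      ... | true | true = ⊥-elim (free (toℕ t)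
              (Equivalence.from T-≡ (trans (sym (lookupW t)) e₁))
              (Equivalence.from T-≡ (trans (trans (g-%p (suc (toℕ t))) (sym (lookupW-mod (suc (toℕ t))))) e₂)))
    W-achiral : T (achiralᵇ q W)
    W-achiral with Equivalence.to T-∨ (allVec-sound p {λ W → not (noAdjacentOnesᵇ q W) ∨ achiralᵇ q W} (shortWordsAchiral-holds q q<8) W)
    ... | inj₁ not-free = ⊥-elim (false≢true (trans (sym (Equivalence.to T-not-≡ not-free)) (Equivalence.to T-≡ W-free)))
    ... | inj₂ achiral = achiral
    c = proj₁ (anyFin-sound p {λ c → allFin p (reflection-at q W c)} W-achiral)
    rotation-matches : ∀ t → at′ q W (q * toℕ t) ≡ at′ q W (toℕ c + toℕ t)
    rotation-matches t = ==-sound (allFin-sound p {reflection-at q W c} (proj₂ (anyFin-sound p {λ c → allFin p (reflection-at q W c)} W-achiral)) t)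
    -- p divides N, so d ≡ -1 ≡ q modulo p
    d≡q : ModEq q d q
    d≡q = ≡ₘ-cancelʳ {c = 1} (≡ₘ-trans (≡ₘ-reflexive (+-comm d 1))
            (≡ₘ-trans (modEq (n∣m⇒m%n≡0 (suc d) p (Period.period∣N mp)))
              (≡ₘ-trans (≡ₘ-sym (≡ₘ-modulus {q})) (≡ₘ-reflexive (+-comm 1 q)))))

module Witnesses where
  open Modular
  open CyclicStrings
  open Dihedral
  open UnitVectors
  open ZeroIsFixed
  open Periods
  open OrbitCounting

  -- Strings realising every orbit size allowed by the theorem:
  --  • 0, with orbit {0} of size 1;
  --  • for 2 ≤ k ∣ n, the string with 1s exactly at the multiples of k:
  --    period k and symmetric, so orbit size k;
  --  • for 9 ≤ p ∣ n, the string with 1s exactly at positions ≡ 0, 2, 5 (mod p):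
  --    period p and chiral, so orbit size 2p.
  module _ {d : ℕ} where
    private
      N = suc d
      V = Vec Bool N

    -- the pattern f on ℤ/(1+e), repeated around the cycle (1+e must divide N)
    repeat : ℕ → (ℕ → Bool) → V
    repeat e f = tab (λ j → f (j % suc e))

    module Repeat (e : ℕ) (f : ℕ → Bool) (p∣N : suc e ∣ N) where
      private
        p = suc e
        v = repeat e f

      ix-repeat : ∀ i → ix v i ≡ f (i % p)
      ix-repeat i = trans (ix-tab {d} (λ j → f (j % p)) i) (cong f (m∣n⇒o%n%m≡o%m p N i p∣N))

      rot-period : rot p v ≡ v
      rot-period = ix-ext λ i → begin
        ix (rot p v) i     ≡⟨ ix-rot p v i ⟩
        ix v (p + i)       ≡⟨ ix-repeat (p + i) ⟩
        f ((p + i) % p)    ≡⟨ cong f (trans (cong (_% p) (+-comm p i)) ([m+n]%n≡m%n i p)) ⟩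
        f (i % p)          ≡⟨ ix-repeat i ⟨
        ix v i             ∎
        where open ≡-Reasoning

      rotation-invariance : ∀ {i} → rot i v ≡ v → ∀ j → f ((i + j) % p) ≡ f (j % p)
      rotation-invariance {i} e j = trans (sym (ix-repeat (i + j))) (trans (sym (ix-rot i v j)) (trans (ix-cong e j) (ix-repeat j)))

      reflection-rotation : ∀ {c} → ref v ≡ rot c v → ∀ j → f ((d * j) % p) ≡ f ((c + j) % p)
      reflection-rotation {c} e j = trans (sym (ix-repeat (d * j)))
        (trans (sym (ix-ref v j)) (trans (ix-cong e j) (trans (ix-rot c v j) (ix-repeat (c + j)))))

      -- modulo a divisor of N we have d ≡ -1, i.e. d·i + i ≡ 0
      d*i+i≡ₚ0 : ∀ i → ModEq e (d * i + i) 0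
      d*i+i≡ₚ0 i = ≡ₘ-trans (≡ₘ-reflexive (trans (+-comm (d * i) i) (trans (cong (i +_) (*-comm d i)) (sym (*-suc i d)))))
        (modEq (n∣m⇒m%n≡0 (i * N) p (∣n⇒∣m*n i p∣N)))

      d*i≡ₚp∸i : ∀ i → i ≤ p → (d * i) % p ≡ (p ∸ i) % p
      d*i≡ₚp∸i i i≤p = residues (≡ₘ-cancelʳ {e} {c = i} (≡ₘ-trans (d*i+i≡ₚ0 i)
        (≡ₘ-sym (≡ₘ-trans (≡ₘ-reflexive (m∸n+n≡m i≤p)) (≡ₘ-modulus {e})))))

    zero-orbit : DihedralOrbitOfSize (zeroV {d}) 1
    zero-orbit = achiral-orbit zeroV 0
      (record { periodic = rot-zeros 1 ; minimal = λ { (suc i) _ () } })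
      (0 , trans ref-zeros (sym (rot-zeros 0)))

    multiples-orbit : ∀ r → suc (suc r) ∣ N → ∃ λ (x : Vertex N) → DihedralOrbitOfSize x (suc (suc r))
    multiples-orbit r k∣N = x , achiral-orbit x (suc r) minimal-k (0 , symmetric)
      where
      open Repeat (suc r) (_≡ᵇ 0) k∣N
      v = repeat (suc r) (_≡ᵇ 0)
      ix-v : ∀ i → ix v i ≡ δ {suc r} i 0
      ix-v = ix-repeat
      free : NoAdjacentOnes v
      free i a b = i≢ₘi+1 {suc r} (s≤s z≤n) i (≡ₘ-trans (δ⇒≡ₘ {suc r} {i} {0} (subst T (ix-v i) a))
                                                      (≡ₘ-sym (δ⇒≡ₘ {suc r} {suc i} {0} (subst T (ix-v (suc i)) b))))
      x : Vertex N
      x = v , noAdjacentOnes⇒lucas v free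
      minimal-k : MinimalPeriod (suc r) v
      minimal-k = record { periodic = rot-period ; minimal = smaller }
        where
        smaller : ∀ i → 1 ≤ i → i ≤ suc r → rot i v ≢ v
        smaller i 1≤i i≤r+1 e with ≡ₘ⇒≡ {suc r} (s≤s i≤r+1) z<s (δ⇒≡ₘ {suc r} {i} {0} (Equivalence.from T-≡
          (trans (cong (λ t → t % suc (suc r) ≡ᵇ 0) (sym (+-identityʳ i))) (rotation-invariance {i} e 0))))
        smaller .0 () _ _ | refl
      symmetric : ref v ≡ rot 0 v
      symmetric = ix-ext λ i → begin
        ix (ref v) i         ≡⟨ ix-ref v i ⟩
        ix v (d * i)         ≡⟨ ix-v (d * i) ⟩
        δ (d * i) 0          ≡⟨ δ-resp {suc r} {d * i} {0} {i} {0} (-i≡0⇒i≡0 {i}) (i≡0⇒-i≡0 {i}) ⟩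
        δ i 0                ≡⟨ ix-v i ⟨
        ix v i               ≡⟨ ix-rot 0 v i ⟨
        ix (rot 0 v) i       ∎
        where
        open ≡-Reasoning
        -i≡0⇒i≡0 : ∀ {i} → ModEq (suc r) (d * i) 0 → ModEq (suc r) i 0
        -i≡0⇒i≡0 {i} c = ≡ₘ-trans (≡ₘ-sym (≡ₘ-+ {suc r} {d * i} {0} {i} {i} c ≡ₘ-refl)) (d*i+i≡ₚ0 i)
        i≡0⇒-i≡0 : ∀ {i} → ModEq (suc r) i 0 → ModEq (suc r) (d * i) 0
        i≡0⇒-i≡0 c = ≡ₘ-trans (≡ₘ-* (≡ₘ-refl {a = d}) c) (≡ₘ-reflexive (*-zeroʳ d))

    marks : ℕ → Bool
    marks t = (t ≡ᵇ 0) ∨ (t ≡ᵇ 2) ∨ (t ≡ᵇ 5)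

    marked : ∀ t → T (marks t) → t ≡ 0 ⊎ t ≡ 2 ⊎ t ≡ 5
    marked 0 _ = inj₁ refl
    marked 2 _ = inj₂ (inj₁ refl)
    marked 5 _ = inj₂ (inj₂ refl)
    marked 1 ()
    marked 3 ()
    marked 4 ()
    marked (suc (suc (suc (suc (suc (suc t)))))) ()

    chiral-orbit-of : ∀ r → 9 + r ∣ N → ∃ λ (x : Vertex N) → DihedralOrbitOfSize x ((9 + r) + (9 + r))
    chiral-orbit-of r p∣N = x , chiral-orbit x (8 + r) minimal-p not-achiral
      where
      p = 9 + r
      open Repeat (8 + r) marks p∣N
      v = repeat (8 + r) marks
      -- a mark at t is never followed by a mark at t+1, as t ∈ {0,2,5} and p > 6
      free : NoAdjacentOnes v
      free i a b = false≢true (begin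
        false                 ≡⟨ after mark ⟨
        marks (suc (i % p))   ≡⟨ cong marks i+1%p ⟨
        marks (suc i % p)     ≡⟨ ix-repeat (suc i) ⟨
        ix v (suc i)          ≡⟨ Equivalence.to T-≡ b ⟩
        true                  ∎)
        where
        open ≡-Reasoning
        mark = marked (i % p) (subst T (ix-repeat i) a)
        after : ∀ {t} → t ≡ 0 ⊎ t ≡ 2 ⊎ t ≡ 5 → marks (suc t) ≡ false
        after (inj₁ refl) = refl
        after (inj₂ (inj₁ refl)) = refl
        after (inj₂ (inj₂ refl)) = refl
        small : ∀ {t} → t ≡ 0 ⊎ t ≡ 2 ⊎ t ≡ 5 → suc t < p
        small (inj₁ refl) = s≤s (s≤s z≤n)
        small (inj₂ (inj₁ refl)) = s≤s (s≤s (s≤s (s≤s z≤n)))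
        small (inj₂ (inj₂ refl)) = s≤s (s≤s (s≤s (s≤s (s≤s (s≤s (s≤s z≤n))))))
        i+1%p : suc i % p ≡ suc (i % p)
        i+1%p = trans (%-distribˡ-+ 1 i p) (m<n⇒m%n≡m (small mark))
      x : Vertex N
      x = v , noAdjacentOnes⇒lucas v free
      minimal-p : MinimalPeriod (8 + r) v
      minimal-p = record { periodic = rot-period ; minimal = smaller }
        where
        -- rot i v = v needs a mark at i, hence i ∈ {2,5}, and then a mark at i + 2
        smaller : ∀ i → 1 ≤ i → i ≤ 8 + r → rot i v ≢ v
        smaller i 1≤i i≤8+r e with marked i (subst T (trans (sym (rotation-invariance {i} e 0))
                                     (cong marks (trans (cong (_% p) (+-identityʳ i)) (m<n⇒m%n≡m (s≤s i≤8+r))))) tt)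
        ... | inj₁ refl = <-irrefl refl 1≤i
        ... | inj₂ (inj₁ refl) = false≢true (rotation-invariance {i} e 2)
        ... | inj₂ (inj₂ refl) = false≢true (rotation-invariance {i} e 2)
      -- if ref v = rot c v then c ∈ {0,2,5} mod p, and each case fails at one position
      not-achiral : ¬ Achiral v
      not-achiral (c , e) = by-cases (marked (c % p) mark-at-c)
        where
        mirror : ∀ j → marks ((d * j) % p) ≡ marks ((c % p + j) % p)
        mirror j = trans (reflection-rotation {c} e j) (cong marks (residues (≡ₘ-+ {8 + r} (≡ₘ-sym (≡ₘ-% c)) (≡ₘ-refl {a = j}))))
        mark-at-c : T (marks (c % p))
        mark-at-c = subst T (trans (mirror 0) (cong marks (trans (cong (_% p) (+-identityʳ (c % p))) (m%n%n≡m%n c p))))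
                      (subst T (cong (λ t → marks (t % p)) (sym (*-zeroʳ d))) tt)
        reflected : ∀ j t → j + t ≡ p → 1 ≤ j → marks ((d * j) % p) ≡ marks t
        reflected j t j+t≡p 1≤j = cong marks (begin
          (d * j) % p     ≡⟨ d*i≡ₚp∸i j (subst (j ≤_) j+t≡p (m≤m+n j t)) ⟩
          (p ∸ j) % p     ≡⟨ cong (λ m → (m ∸ j) % p) j+t≡p ⟨
          (j + t ∸ j) % p ≡⟨ cong (_% p) (m+n∸m≡n j t) ⟩
          t % p           ≡⟨ m<n⇒m%n≡m (subst (t <_) j+t≡p (m<n+m t 1≤j)) ⟩
          t               ∎)
          where open ≡-Reasoning
        by-cases : c % p ≡ 0 ⊎ c % p ≡ 2 ⊎ c % p ≡ 5 → ⊥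
        by-cases (inj₁ c≡0) = false≢true (trans (sym (reflected 2 (7 + r) refl (s≤s z≤n)))
          (trans (mirror 2) (cong (λ t → marks ((t + 2) % p)) c≡0)))
        by-cases (inj₂ (inj₁ c≡2)) = false≢true (trans (sym (reflected 3 (6 + r) refl (s≤s z≤n)))
          (trans (mirror 3) (cong (λ t → marks ((t + 3) % p)) c≡2)))
        by-cases (inj₂ (inj₂ c≡5)) = false≢true (trans (sym (reflected (6 + r) 3 (+-comm (6 + r) 3) (s≤s z≤n)))
          (trans (mirror (6 + r)) (trans (cong (λ t → marks ((t + (6 + r)) % p)) c≡5) (cong marks ([m+n]%n≡m%n 2 p)))))

module OrbitSizes where
  open Modular
  open CyclicStrings
  open UnitVectors
  open Rigidity
  open Periods
  open OrbitCounting
  open ShortPeriods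
  open Witnesses

  AllowedSize : ℕ → ℕ → Set
  AllowedSize n k = (1 ≤ k × k ∣ n) ⊎ (18 ≤ k × k ∣ 2 * n)

  odd⇒coprime-2 : ∀ k → k % 2 ≡ 1 → Coprime k 2
  odd⇒coprime-2 k odd {zero} (_ , 0∣2) with 0∣⇒≡0 0∣2
  ... | ()
  odd⇒coprime-2 k odd {suc zero} _ = refl
  odd⇒coprime-2 k odd {suc (suc zero)} (2∣k , _) with trans (sym odd) (n∣m⇒m%n≡0 k 2 2∣k)
  ... | ()
  odd⇒coprime-2 k odd {suc (suc (suc i))} (_ , i+3∣2) with ∣⇒≤ i+3∣2
  ... | s≤s (s≤s ())

  module _ {d : ℕ} where
    private
      N = suc d

    -- orbits have size p (period p, achiral) or 2p (period p ≥ 9, chiral)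
    orbit-size⇒allowed : ∀ k → IsOrbitSize N k → AllowedSize N k
    orbit-size⇒allowed k (x , xs , unique , len , members) with minimal-period (proj₁ x)
    ... | q , mp with achiral? mp
    ... | yes achiral = inj₁ (subst (1 ≤_) k≡p (s≤s z≤n) , subst (_∣ N) k≡p (Period.period∣N mp))
      where
      k≡p : suc q ≡ k
      k≡p = trans (sym (orbit-size-unique xs unique members (achiral-orbit x q mp achiral))) len
    ... | no chiral with q <? 8
    ... | yes q<8 = ⊥-elim (chiral (short-period⇒achiral (proj₁ x) q q<8 mp (noAdjacentOnes x)))
    ... | no q≮8 = inj₂ (subst (18 ≤_) k≡2p (+-mono-≤ (s≤s 8≤q) (s≤s 8≤q)) , subst (_∣ 2 * N) k≡2p (subst (_∣ 2 * N) 2*p≡p+p (*-monoʳ-∣ 2 (Period.period∣N mp))))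
      where
      8≤q : 8 ≤ q
      8≤q = ≮⇒≥ q≮8
      2*p≡p+p : 2 * suc q ≡ suc q + suc q
      2*p≡p+p = cong (suc q +_) (+-identityʳ (suc q))
      k≡2p : suc q + suc q ≡ k
      k≡2p = trans (sym (orbit-size-unique xs unique members (chiral-orbit x q mp chiral))) len

    divisor-orbit-size : ∀ k → 1 ≤ k → k ∣ N → IsOrbitSize N k
    divisor-orbit-size (suc zero) _ _ = dihedralOrbitSize⇒IsOrbitSize (zeroV , zero-orbit)
    divisor-orbit-size (suc (suc r)) _ k∣N = dihedralOrbitSize⇒IsOrbitSize (multiples-orbit r k∣N)

    allowed⇒orbit-size : ∀ k → AllowedSize N k → IsOrbitSize N k
    allowed⇒orbit-size k (inj₁ (1≤k , k∣N)) = divisor-orbit-size k 1≤k k∣N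
    allowed⇒orbit-size k (inj₂ (18≤k , k∣2N)) with k % 2 in parity | m%n<n k 2
    -- k odd: then k ∣ N
    ... | 1 | _ = divisor-orbit-size k (≤-trans {1} {18} (s≤s z≤n) 18≤k) (coprime-divisor (odd⇒coprime-2 k parity) k∣2N)
    ... | suc (suc _) | s≤s (s≤s ())
    -- k = 2m even: then 9 ≤ m ∣ N
    ... | 0 | _ = subst (IsOrbitSize N) (trans (cong₂ _+_ 9+r≡m 9+r≡m) (sym k≡m+m))
                    (dihedralOrbitSize⇒IsOrbitSize (chiral-orbit-of r (subst (_∣ N) (sym 9+r≡m) m∣N)))
      where
      m = k / 2
      k≡m+m : k ≡ m + m
      k≡m+m = trans (m≡m%n+[m/n]*n k 2) (trans (cong (_+ m * 2) parity) (trans (*-comm m 2) (cong (m +_) (+-identityʳ m))))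
      m∣N : m ∣ N
      m∣N = *-cancelˡ-∣ 2 (subst (_∣ 2 * N) (trans k≡m+m (cong (m +_) (sym (+-identityʳ m)))) k∣2N)
      9≤m : 9 ≤ m
      9≤m with 9 ≤? m
      ... | yes 9≤m = 9≤m
      ... | no 9≰m = ⊥-elim (<⇒≱ (+-mono-< (≰⇒> 9≰m) (≰⇒> 9≰m)) (subst (18 ≤_) k≡m+m 18≤k))
      r = m ∸ 9
      9+r≡m : 9 + r ≡ m
      9+r≡m = m+[n∸m]≡n 9≤m

open OrbitSizes using (orbit-size⇒allowed; allowed⇒orbit-size)

theorem5p2 : (n : ℕ) → 1 ≤ n → (k : ℕ) →
    IsOrbitSize n k ⇔ ((1 ≤ k × k ∣ n) ⊎ (18 ≤ k × k ∣ 2 * n))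
theorem5p2 (suc d) _ k = mk⇔ (orbit-size⇒allowed k) (allowed⇒orbit-size k)
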